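{- Let $P$ and $Q$ be finite naturally labeled posets with $K_P(\mathbf{x}) = K_Q(\mathbf{x})$. Then for every $m\ge 0$, $P$ and $Q$ have the same number of antichains of size $m$.
   Context: A poset $(P,\preceq)$ on ground set $[n]=\{1,\dots,n\}$ is naturally labeled if $x\preceq y$ implies $x\le y$ as integers. For such $P$, the $P$-partition generating function is $K_P(\mathbf{x})=\sum_{\sigma}\prod_{p\in P}x_{\sigma(p)}$, the sum over all maps $\sigma:P\to\mathbb{Z}^+$ with $\sigma(x)\le\sigma(y)$ whenever $x\preceq y$. An antichain is a set of pairwise incomparable elements. -}

module Defs where

open import Data.Nat using (ℕ; zero; suc; _≤_)
open import Data.Nat.Properties using () renaming (_≟_ to _≟ℕ_)
open import Data.Fin using (Fin; toℕ) renaming (_≤_ to _≤ᶠ_)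
open import Data.Fin.Properties using (all?; _≟_) renaming (_≤?_ to _≤ᶠ?_)
open import Data.Fin.Subset using (Subset; _∈_; ∣_∣)
open import Data.Fin.Subset.Properties using (_∈?_)
open import Data.Bool using (Bool; true; false)
open import Data.Vec using (Vec; []; _∷_; lookup)
open import Data.List using (List; []; _∷_; map; concatMap; filter; length; allFin)
open import Data.Product using (_×_)
open import Relation.Binary.Core using (Rel)
open import Relation.Binary.Definitions using (Decidable)
open import Relation.Binary.Structures using (IsPartialOrder)
open import Relation.Binary.PropositionalEquality using (_≡_)
open import Relation.Nullary using (¬_; Dec)
open import Relation.Nullary.Decidable using (_→-dec_; _×-dec_; ¬?)

-- A finite naturally labeled poset on the ground set [n], represented as Fin n
-- (element i : Fin n stands for the label toℕ i + 1).
record NLPoset (n : ℕ) : Set₁ where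
  field
    _≼_            : Rel (Fin n) _
    isPartialOrder : IsPartialOrder _≡_ _≼_
    _≼?_           : Decidable _≼_
    natural        : ∀ {x y} → x ≼ y → toℕ x ≤ toℕ y

count : ∀ {A : Set} {P : A → Set} → (∀ a → Dec (P a)) → List A → ℕ
count P? xs = length (filter P? xs)

allVecs : ∀ {A : Set} → List A → (n : ℕ) → List (Vec A n)
allVecs xs zero    = [] ∷ []
allVecs xs (suc n) = concatMap (λ x → map (x ∷_) (allVecs xs n)) xs

allMaps : (n k : ℕ) → List (Vec (Fin k) n)
allMaps n k = allVecs (allFin k) n

allSubsets : (n : ℕ) → List (Subset n)
allSubsets n = allVecs (true ∷ false ∷ []) n

module _ {n : ℕ} (P : NLPoset n) where
  open NLPoset P

  IsPPartition : ∀ {k} → Vec (Fin k) n → Set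
  IsPPartition σ = ∀ x y → x ≼ y → lookup σ x ≤ᶠ lookup σ y

  isPPartition? : ∀ {k} (σ : Vec (Fin k) n) → Dec (IsPPartition σ)
  isPPartition? σ = all? (λ x → all? (λ y → (x ≼? y) →-dec (lookup σ x ≤ᶠ? lookup σ y)))

  fiberSize : ∀ {k} → Vec (Fin k) n → Fin k → ℕ
  fiberSize σ i = count (λ x → lookup σ x ≟ i) (allFin n)

  HasContent : ∀ {k} → Vec (Fin k) n → (Fin k → ℕ) → Set
  HasContent σ α = ∀ i → fiberSize σ i ≡ α i

  hasContent? : ∀ {k} (σ : Vec (Fin k) n) (α : Fin k → ℕ) → Dec (HasContent σ α)
  hasContent? σ α = all? (λ i → fiberSize σ i ≟ℕ α i)

  -- Coefficient of the monomial x₁^{α 0} ⋯ x_k^{α (k-1)} in K_P(x):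
  -- the number of P-partitions σ with |σ⁻¹(i)| = α i for every i.
  -- (Every monomial only involves x₁,…,x_k for some k, and such σ take values in [k].)
  coeffK : (k : ℕ) → (Fin k → ℕ) → ℕ
  coeffK k α = count (λ σ → isPPartition? σ ×-dec hasContent? σ α) (allMaps n k)

  IsAntichain : Subset n → Set
  IsAntichain S = ∀ x y → x ∈ S → y ∈ S → ¬ (x ≡ y) → ¬ (x ≼ y)

  isAntichain? : (S : Subset n) → Dec (IsAntichain S)
  isAntichain? S = all? (λ x → all? (λ y →
    (x ∈? S) →-dec ((y ∈? S) →-dec (¬? (x ≟ y) →-dec ¬? (x ≼? y)))))

  numAntichains : ℕ → ℕ
  numAntichains m = count (λ S → isAntichain? S ×-dec (∣ S ∣ ≟ℕ m)) (allSubsets n)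

SameK : ∀ {n n'} → NLPoset n → NLPoset n' → Set
SameK P Q = ∀ (k : ℕ) (α : Fin k → ℕ) → coeffK P k α ≡ coeffK Q k α

-- Fix j.  Call σ : P → {0, …, j+1} marked if it is a P-partition whose levels
-- 1, …, j are singletons and which has no ascent at the levels 1, …, j-1 (an
-- ascent at level i: every label on level i is below every label on level i+1).
-- Marked maps correspond bijectively to pairs (A, B) of an antichain A and a
-- j-subset B ⊆ A, so there are Σₘ (m C j)·aₘ of them, aₘ being the number of
-- antichains of size m.  On the other hand, the number of P-partitions with a
-- given content and no ascent at a given set of levels is determined by K_P:
-- forbidding an ascent at level i removes the maps with an ascent there, and
-- these correspond (by merging the levels i and i+1) to maps with one level
-- fewer.  Sorting marked maps by the sizes of their levels 0 and j+1 shows that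
-- K_P determines Σₘ (m C j)·aₘ for every j, and binomial inversion recovers aₘ.

module Submission where

open import Defs
open import Data.Nat using (ℕ; zero; suc; _+_; _*_; _∸_; _≤_; _<_; z≤n; s≤s; _≤?_; _<?_)
open import Data.Nat.Properties
open import Data.Nat.Combinatorics using (_C_; nCn≡1; k>n⇒nCk≡0; nCk+nC[k+1]≡[n+1]C[k+1])
open import Data.Bool using (Bool; true; false; if_then_else_; _∧_)
import Data.Bool as Bool
open import Data.List using (List; []; _∷_; map; filter; length; _++_; allFin; tabulate; cartesianProduct)
open import Data.Nat.ListAction using (sum)
import Data.List.Properties as List
open import Data.List.Membership.Propositional using (_∈_)
open import Data.List.Membership.Propositional.Properties
  using (∈-filter⁺; ∈-filter⁻; ∈-map⁺; ∈-map⁻; ∈-concat⁺′; ∈-allFin; ∈-cartesianProduct⁺)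
open import Data.List.Membership.Propositional.Properties.WithK using (unique∧set⇒bag)
open import Data.List.Relation.Binary.BagAndSetEquality using (∼bag⇒↭)
open import Data.List.Relation.Binary.Permutation.Propositional.Properties using (↭-length)
open import Data.List.Relation.Binary.Disjoint.Propositional using (Disjoint)
open import Data.List.Relation.Unary.Any using (here; there)
open import Data.List.Relation.Unary.All using (All; []; _∷_)
open import Data.List.Relation.Unary.AllPairs using ([]; _∷_)
import Data.List.Relation.Unary.AllPairs as AllPairs
import Data.List.Relation.Unary.AllPairs.Properties as AllPairsₚ
open import Data.List.Relation.Unary.Unique.Propositional using (Unique)
import Data.List.Relation.Unary.Unique.Propositional.Properties as Unique
open import Data.Fin using (Fin; toℕ; fromℕ<) renaming (zero to fzero; suc to fsuc)
open import Data.Fin.Properties using (all?; any?; toℕ-injective; toℕ<n; toℕ-fromℕ<)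
import Data.Fin.Properties as Fin
open import Data.Fin.Subset using (Subset; ∣_∣; _⊆_) renaming (_∈_ to _∈ₛ_)
open import Data.Fin.Subset.Properties using (∣p∣≤n; _∈?_; _⊆?_; drop-there; in⊆in; out⊆; drop-∷-⊆)
open import Data.Vec using (Vec; lookup; replicate; here; there) renaming ([] to []ᵥ; _∷_ to _∷ᵥ_)
import Data.Vec as Vec
open import Data.Vec.Properties using (lookup-map; lookup∘tabulate; tabulate∘lookup; tabulate-cong; lookup-replicate; []=⇒lookup; lookup⇒[]=)
open import Data.Product using (∃; _×_; _,_; proj₁; proj₂)
open import Data.Sum using (_⊎_; inj₁; inj₂)
open import Data.Empty using (⊥-elim)
open import Function.Bundles using (mk⇔; _⇔_; Equivalence)
open import Relation.Nullary using (¬_; Dec; yes; no; does)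
open import Relation.Nullary.Decidable using (_×-dec_; ¬?; _→-dec_; dec-true; dec-false; decidable-stable)
open import Relation.Binary.Definitions using (tri<; tri≈; tri>)
open import Relation.Binary.Structures using (IsPartialOrder)
open import Relation.Binary.PropositionalEquality using (_≡_; _≢_; refl; sym; trans; cong; cong₂; subst; subst₂; module ≡-Reasoning)

bit : Bool → ℕ
bit true  = 1
bit false = 0

bit-yes : ∀ {A : Set} (d : Dec A) → A → bit (does d) ≡ 1
bit-yes d a rewrite dec-true d a = refl

bit-no : ∀ {A : Set} (d : Dec A) → ¬ A → bit (does d) ≡ 0
bit-no d ¬a rewrite dec-false d ¬a = refl

does-true⇒ : ∀ {A : Set} (d : Dec A) → does d ≡ true → A
does-true⇒ (yes a) _ = a

does-false⇒ : ∀ {A : Set} (d : Dec A) → does d ≡ false → ¬ A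
does-false⇒ (no ¬a) _ = ¬a

false≢true : false ≢ true
false≢true ()

module _ {A : Set} where

  count-∷ : ∀ {P : A → Set} (P? : ∀ a → Dec (P a)) x xs →
    count P? (x ∷ xs) ≡ bit (does (P? x)) + count P? xs
  count-∷ P? x xs with P? x
  ... | yes _ = refl
  ... | no  _ = refl

  count-ext : ∀ {P Q : A → Set} (P? : ∀ a → Dec (P a)) (Q? : ∀ a → Dec (Q a)) →
    (∀ x → P x → Q x) → (∀ x → Q x → P x) → ∀ xs → count P? xs ≡ count Q? xs
  count-ext P? Q? f g xs = cong length (List.filter-≐ P? Q? ((λ {x} → f x) , (λ {x} → g x)) xs)

  count-split : ∀ {P Q : A → Set} (P? : ∀ a → Dec (P a)) (Q? : ∀ a → Dec (Q a)) → ∀ xs →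
    count P? xs ≡ count (λ x → P? x ×-dec Q? x) xs + count (λ x → P? x ×-dec ¬? (Q? x)) xs
  count-split P? Q? [] = refl
  count-split P? Q? (x ∷ xs) with P? x | Q? x
  ... | yes _ | yes _ = cong suc (count-split P? Q? xs)
  ... | yes _ | no  _ = trans (cong suc (count-split P? Q? xs)) (sym (+-suc _ _))
  ... | no  _ | yes _ = count-split P? Q? xs
  ... | no  _ | no  _ = count-split P? Q? xs

  count-mono : ∀ {P Q : A → Set} (P? : ∀ a → Dec (P a)) (Q? : ∀ a → Dec (Q a)) →
    (∀ x → P x → Q x) → ∀ xs → count P? xs ≤ count Q? xs
  count-mono P? Q? f [] = z≤n
  count-mono P? Q? f (x ∷ xs) with P? x | Q? x
  ... | yes _ | yes _  = s≤s (count-mono P? Q? f xs)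
  ... | yes p | no ¬q  = ⊥-elim (¬q (f x p))
  ... | no  _ | yes _  = m≤n⇒m≤1+n (count-mono P? Q? f xs)
  ... | no  _ | no  _  = count-mono P? Q? f xs

  count-++ : ∀ {P : A → Set} (P? : ∀ a → Dec (P a)) xs ys →
    count P? (xs ++ ys) ≡ count P? xs + count P? ys
  count-++ P? xs ys = trans (cong length (List.filter-++ P? xs ys)) (List.length-++ (filter P? xs))

  count-zero : ∀ {P : A → Set} (P? : ∀ a → Dec (P a)) → (∀ x → ¬ P x) → ∀ xs → count P? xs ≡ 0
  count-zero P? f [] = refl
  count-zero P? f (x ∷ xs) with P? x
  ... | yes p = ⊥-elim (f x p)
  ... | no  _ = count-zero P? f xs

  count-all : ∀ {P : A → Set} (P? : ∀ a → Dec (P a)) → (∀ x → P x) → ∀ xs → count P? xs ≡ length xs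
  count-all P? f [] = refl
  count-all P? f (x ∷ xs) with P? x
  ... | yes _ = cong suc (count-all P? f xs)
  ... | no ¬p = ⊥-elim (¬p (f x))

  count-witness : ∀ {P : A → Set} (P? : ∀ a → Dec (P a)) xs → 0 < count P? xs → ∃ P
  count-witness P? (x ∷ xs) h with P? x
  ... | yes p = x , p
  ... | no  _ = count-witness P? xs h

  count-positive : ∀ {P : A → Set} (P? : ∀ a → Dec (P a)) {a} xs → P a → a ∈ xs → 0 < count P? xs
  count-positive P? (x ∷ xs) pa a∈ with P? x | a∈
  ... | yes _ | _          = s≤s z≤n
  ... | no ¬p | here refl  = ⊥-elim (¬p pa)
  ... | no  _ | there a∈xs = count-positive P? xs pa a∈xs

  count-two : ∀ {P : A → Set} (P? : ∀ a → Dec (P a)) (eq? : ∀ (a b : A) → Dec (a ≡ b)) xs {a b} →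
    P a → P b → a ≢ b → a ∈ xs → b ∈ xs → 2 ≤ count P? xs
  count-two P? eq? xs {a} pa pb a≢b a∈ b∈ =
    subst (2 ≤_) (sym (count-split P? (λ z → eq? z a) xs))
      (+-mono-≤ (count-positive (λ z → P? z ×-dec eq? z a) xs (pa , refl) a∈)
                (count-positive (λ z → P? z ×-dec ¬? (eq? z a)) xs (pb , λ b≡a → a≢b (sym b≡a)) b∈))

count-map : ∀ {A B : Set} {P : B → Set} (P? : ∀ b → Dec (P b)) (f : A → B) xs →
  count P? (map f xs) ≡ count (λ x → P? (f x)) xs
count-map P? f [] = refl
count-map P? f (x ∷ xs) with P? (f x)
... | yes _ = cong suc (count-map P? f xs)
... | no  _ = count-map P? f xs

count-allFin-suc : ∀ n {P : Fin (suc n) → Set} (P? : ∀ a → Dec (P a)) →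
  count P? (allFin (suc n)) ≡ bit (does (P? fzero)) + count (λ x → P? (fsuc x)) (allFin n)
count-allFin-suc n P? =
  trans (count-∷ P? fzero (tabulate fsuc))
        (cong (bit (does (P? fzero)) +_) (trans (cong (count P?) (sym (List.map-tabulate (λ x → x) fsuc)))
                                                 (count-map P? fsuc (allFin n))))

vec-ext : ∀ {A : Set} {m} (u v : Vec A m) → (∀ x → lookup u x ≡ lookup v x) → u ≡ v
vec-ext u v same = trans (sym (tabulate∘lookup u)) (trans (tabulate-cong same) (tabulate∘lookup v))

module _ {A B : Set} where

  private
    map-unique-on : (f : A → B) → ∀ xs → (∀ a a' → a ∈ xs → a' ∈ xs → f a ≡ f a' → a ≡ a') →
      Unique xs → Unique (map f xs)
    map-unique-on f [] inj [] = []
    map-unique-on f (x ∷ xs) inj (x∉ ∷ u) =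
      fresh xs (λ a a∈ → inj x a (here refl) (there a∈)) x∉ ∷
      map-unique-on f xs (λ a a' a∈ a'∈ → inj a a' (there a∈) (there a'∈)) u
      where
      fresh : ∀ ys → (∀ a → a ∈ ys → f x ≡ f a → x ≡ a) → All (x ≢_) ys → All (f x ≢_) (map f ys)
      fresh [] _ [] = []
      fresh (a ∷ ys) inj' (x≢a ∷ x∉ys) =
        (λ e → x≢a (inj' a (here refl) e)) ∷ fresh ys (λ a' a'∈ → inj' a' (there a'∈)) x∉ys

  count-bijection : ∀ {P : A → Set} {Q : B → Set} (P? : ∀ a → Dec (P a)) (Q? : ∀ b → Dec (Q b))
    (xs : List A) (ys : List B) → Unique xs → Unique ys →
    (∀ a → P a → a ∈ xs) → (∀ b → Q b → b ∈ ys) →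
    (f : A → B) (g : B → A) → (∀ a → P a → Q (f a)) → (∀ b → Q b → P (g b)) →
    (∀ a → P a → g (f a) ≡ a) → (∀ b → Q b → f (g b) ≡ b) → count P? xs ≡ count Q? ys
  count-bijection {P} P? Q? xs ys uxs uys xs-complete ys-complete f g fPQ gQP gf fg =
    trans (sym (List.length-map f Ps))
          (↭-length (∼bag⇒↭ (unique∧set⇒bag f[Ps]-unique (Unique.filter⁺ Q? uys) (mk⇔ to from))))
    where
    Ps : List A
    Ps = filter P? xs
    sat : ∀ {a} → a ∈ Ps → P a
    sat a∈ = proj₂ (∈-filter⁻ P? {xs = xs} a∈)
    f[Ps]-unique : Unique (map f Ps)
    f[Ps]-unique = map-unique-on f Ps
      (λ a a' a∈ a'∈ e → trans (sym (gf a (sat a∈))) (trans (cong g e) (gf a' (sat a'∈))))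
      (Unique.filter⁺ P? uxs)
    to : ∀ {b} → b ∈ map f Ps → b ∈ filter Q? ys
    to b∈ with ∈-map⁻ f b∈
    ... | a , a∈ , refl = ∈-filter⁺ Q? (ys-complete _ (fPQ a (sat a∈))) (fPQ a (sat a∈))
    from : ∀ {b} → b ∈ filter Q? ys → b ∈ map f Ps
    from {b} b∈ = let qb = proj₂ (∈-filter⁻ Q? {xs = ys} b∈) in
      subst (_∈ map f Ps) (fg b qb) (∈-map⁺ f (∈-filter⁺ P? (xs-complete _ (gQP b qb)) (gQP b qb)))

module _ {A : Set} where

  allVecs-complete : (xs : List A) → (∀ a → a ∈ xs) → ∀ n (v : Vec A n) → v ∈ allVecs xs n
  allVecs-complete xs all∈ zero []ᵥ = here refl
  allVecs-complete xs all∈ (suc n) (a ∷ᵥ v) =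
    ∈-concat⁺′ (∈-map⁺ (a ∷ᵥ_) (allVecs-complete xs all∈ n v))
               (∈-map⁺ (λ x → map (x ∷ᵥ_) (allVecs xs n)) (all∈ a))

  allVecs-unique : (xs : List A) → Unique xs → ∀ n → Unique (allVecs xs n)
  allVecs-unique xs u zero = [] ∷ []
  allVecs-unique xs u (suc n) = Unique.concat⁺ (blocks-unique xs) (AllPairsₚ.map⁺ (AllPairs.map disjoint u))
    where
    block : A → List (Vec A (suc n))
    block x = map (x ∷ᵥ_) (allVecs xs n)
    blocks-unique : ∀ ys → All Unique (map block ys)
    blocks-unique [] = []
    blocks-unique (y ∷ ys) = Unique.map⁺ (λ { refl → refl }) (allVecs-unique xs u n) ∷ blocks-unique ys
    disjoint : ∀ {x y} → x ≢ y → Disjoint (block x) (block y)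
    disjoint x≢y (v∈x , v∈y) with ∈-map⁻ _ v∈x | ∈-map⁻ _ v∈y
    ... | _ , _ , refl | _ , _ , e = x≢y (cong Vec.head e)

allMaps-complete : ∀ n k (σ : Vec (Fin k) n) → σ ∈ allMaps n k
allMaps-complete n k σ = allVecs-complete (allFin k) ∈-allFin n σ

allMaps-unique : ∀ n k → Unique (allMaps n k)
allMaps-unique n k = allVecs-unique (allFin k) (Unique.allFin⁺ k) n

allSubsets-complete : ∀ n (S : Subset n) → S ∈ allSubsets n
allSubsets-complete n S = allVecs-complete (true ∷ false ∷ []) (λ { true → here refl ; false → there (here refl) }) n S

allSubsets-unique : ∀ n → Unique (allSubsets n)
allSubsets-unique n = allVecs-unique (true ∷ false ∷ []) (((λ ()) ∷ []) ∷ ([] ∷ [])) n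

allPairs : ∀ n → List (Subset n × Subset n)
allPairs n = cartesianProduct (allSubsets n) (allSubsets n)

allPairs-complete : ∀ n (p : Subset n × Subset n) → p ∈ allPairs n
allPairs-complete n (A , B) = ∈-cartesianProduct⁺ (allSubsets-complete n A) (allSubsets-complete n B)

allPairs-unique : ∀ n → Unique (allPairs n)
allPairs-unique n = Unique.cartesianProduct⁺ (allSubsets-unique n) (allSubsets-unique n)

count-allSubsets-suc : ∀ m {Q : Subset (suc m) → Set} (Q? : ∀ B → Dec (Q B)) →
  count Q? (allSubsets (suc m)) ≡ count (λ B → Q? (true ∷ᵥ B)) (allSubsets m) + count (λ B → Q? (false ∷ᵥ B)) (allSubsets m)
count-allSubsets-suc m Q? = trans (count-++ Q? (map (true ∷ᵥ_) (allSubsets m)) _)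
  (cong₂ _+_ (count-map Q? (true ∷ᵥ_) (allSubsets m))
             (trans (count-++ Q? (map (false ∷ᵥ_) (allSubsets m)) []) (trans (+-identityʳ _) (count-map Q? (false ∷ᵥ_) (allSubsets m)))))

module _ {n : ℕ} {S : Fin n → Set} (S? : ∀ x → Dec (S x)) where

  rank : Fin n → ℕ
  rank x = count (λ y → S? y ×-dec (toℕ y <? toℕ x)) (allFin n)

  rank-mono : ∀ x y → toℕ x ≤ toℕ y → rank x ≤ rank y
  rank-mono x y x≤y = count-mono _ _ (λ z (z∈S , z<x) → z∈S , <-≤-trans z<x x≤y) (allFin n)

  rank-inv : ∀ x y → rank x < rank y → toℕ x < toℕ y
  rank-inv x y r< with toℕ x <? toℕ y
  ... | yes x<y = x<y
  ... | no  x≮y = ⊥-elim (<-irrefl refl (<-≤-trans r< (rank-mono y x (≮⇒≥ x≮y))))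

  rank<size : ∀ x → S x → rank x < count S? (allFin n)
  rank<size x x∈S =
    subst (rank x <_) (sym (count-split S? (λ y → toℕ y <? toℕ x) (allFin n)))
      (≤-trans (≤-reflexive (+-comm 1 (rank x)))
               (+-monoʳ-≤ (rank x) (count-positive (λ y → S? y ×-dec ¬? (toℕ y <? toℕ x)) (allFin n)
                                                   (x∈S , <-irrefl refl) (∈-allFin x))))

module _ (m : ℕ) {S : Fin (suc m) → Set} (S? : ∀ x → Dec (S x)) where

  private
    S⁺? : ∀ x → Dec (S (fsuc x))
    S⁺? x = S? (fsuc x)

    shift : ∀ x → count (λ y → S? y ×-dec (toℕ y <? toℕ (fsuc x))) (allFin (suc m))
                ≡ bit (does (S? fzero ×-dec (0 <? suc (toℕ x)))) + rank S⁺? x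
    shift x = trans (count-allFin-suc m (λ y → S? y ×-dec (toℕ y <? toℕ (fsuc x))))
      (cong (bit (does (S? fzero ×-dec (0 <? suc (toℕ x)))) +_)
            (count-ext _ _ (λ y (a , b) → a , ≤-pred b) (λ y (a , b) → a , s≤s b) (allFin m)))

  rank-fzero : rank S? fzero ≡ 0
  rank-fzero = count-zero (λ y → S? y ×-dec (toℕ y <? 0)) (λ { y (_ , ()) }) (allFin (suc m))

  rank-fsuc-∈ : ∀ x → S fzero → rank S? (fsuc x) ≡ suc (rank S⁺? x)
  rank-fsuc-∈ x s0 = trans (shift x) (cong (_+ rank S⁺? x) (bit-yes (S? fzero ×-dec (0 <? suc (toℕ x))) (s0 , s≤s z≤n)))

  rank-fsuc-∉ : ∀ x → ¬ S fzero → rank S? (fsuc x) ≡ rank S⁺? x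
  rank-fsuc-∉ x ¬s0 = trans (shift x) (cong (_+ rank S⁺? x) (bit-no (S? fzero ×-dec (0 <? suc (toℕ x))) (λ (s0 , _) → ¬s0 s0)))

count-rank< : ∀ m {S : Fin m → Set} (S? : ∀ x → Dec (S x)) r → r ≤ count S? (allFin m) →
  count (λ x → S? x ×-dec (rank S? x <? r)) (allFin m) ≡ r
count-rank< m S? zero _ = count-zero (λ x → S? x ×-dec (rank S? x <? 0)) (λ { x (_ , ()) }) (allFin m)
count-rank< zero S? (suc r) ()
count-rank< (suc m) {S} S? (suc r) r≤ = by-first-element (S? fzero)
  where
  open ≡-Reasoning
  S⁺? : ∀ x → Dec (S (fsuc x))
  S⁺? y = S? (fsuc y)
  below : ∀ x → Dec (S x × rank S? x < suc r)
  below x = S? x ×-dec (rank S? x <? suc r)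
  size : count S? (allFin (suc m)) ≡ bit (does (S? fzero)) + count S⁺? (allFin m)
  size = count-allFin-suc m S?
  by-first-element : Dec (S fzero) → count below (allFin (suc m)) ≡ suc r
  by-first-element (yes s0) = begin
    count below (allFin (suc m))
      ≡⟨ count-allFin-suc m below ⟩
    bit (does (below fzero)) + count (λ x → below (fsuc x)) (allFin m)
      ≡⟨ cong₂ _+_ (bit-yes (below fzero) (s0 , subst (_< suc r) (sym (rank-fzero m S?)) (s≤s z≤n)))
                   (count-ext _ _ (λ x (a , b) → a , ≤-pred (subst (_< suc r) (rank-fsuc-∈ m S? x s0) b))
                                  (λ x (a , b) → a , subst (_< suc r) (sym (rank-fsuc-∈ m S? x s0)) (s≤s b)) (allFin m)) ⟩
    1 + count (λ x → S⁺? x ×-dec (rank S⁺? x <? r)) (allFin m)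
      ≡⟨ cong suc (count-rank< m S⁺? r (≤-pred (subst (suc r ≤_)
           (trans size (cong (_+ count S⁺? (allFin m)) (bit-yes (S? fzero) s0))) r≤))) ⟩
    suc r ∎
  by-first-element (no ¬s0) = begin
    count below (allFin (suc m))
      ≡⟨ count-allFin-suc m below ⟩
    bit (does (below fzero)) + count (λ x → below (fsuc x)) (allFin m)
      ≡⟨ cong₂ _+_ (bit-no (below fzero) (λ (s0 , _) → ¬s0 s0))
                   (count-ext _ _ (λ x (a , b) → a , subst (_< suc r) (rank-fsuc-∉ m S? x ¬s0) b)
                                  (λ x (a , b) → a , subst (_< suc r) (sym (rank-fsuc-∉ m S? x ¬s0)) b) (allFin m)) ⟩
    count (λ x → S⁺? x ×-dec (rank S⁺? x <? suc r)) (allFin m)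
      ≡⟨ count-rank< m S⁺? (suc r) (subst (suc r ≤_) (trans size (cong (_+ count S⁺? (allFin m)) (bit-no (S? fzero) ¬s0))) r≤) ⟩
    suc r ∎

count-rank≡ : ∀ {m} {S : Fin m → Set} (S? : ∀ x → Dec (S x)) r → r < count S? (allFin m) →
  count (λ x → S? x ×-dec (rank S? x ≟ r)) (allFin m) ≡ 1
count-rank≡ {m} {S} S? r r< = +-cancelˡ-≡ r _ _ (begin
    r + exactly                                  ≡⟨ cong (_+ exactly) (sym (count-rank< m S? r (<⇒≤ r<))) ⟩
    count (below r) (allFin m) + exactly         ≡⟨ sym split ⟩
    count (below (suc r)) (allFin m)             ≡⟨ count-rank< m S? (suc r) r< ⟩
    suc r                                        ≡⟨ +-comm 1 r ⟩
    r + 1                                        ∎)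
  where
  open ≡-Reasoning
  below : ∀ t x → Dec (S x × rank S? x < t)
  below t x = S? x ×-dec (rank S? x <? t)
  exactly : ℕ
  exactly = count (λ x → S? x ×-dec (rank S? x ≟ r)) (allFin m)
  split : count (below (suc r)) (allFin m) ≡ count (below r) (allFin m) + exactly
  split = trans (count-split (below (suc r)) (λ x → rank S? x <? r) (allFin m))
    (cong₂ _+_ (count-ext _ _ (λ x ((a , _) , c) → a , c) (λ x (a , c) → (a , m≤n⇒m≤1+n c) , c) (allFin m))
               (count-ext _ _ (λ x ((a , b) , c) → a , ≤-antisym (≤-pred b) (≮⇒≥ c))
                              (λ x (a , c) → (a , s≤s (≤-reflexive c)) , (λ d → <-irrefl c d)) (allFin m)))

-- A map σ : P → [k] takes values ("levels")
-- 0 … k-1.  'mergeLevel i' identifies the levels i and i+1 (shifting higher levels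
-- down); 'splitLevel i w hi' is a right inverse that sends level i to i or i+1
-- according to the flag 'hi'.  'mergeContent i α' is the content of a merged map.
mergeLevel : ℕ → ℕ → ℕ
mergeLevel zero zero = 0
mergeLevel zero (suc v) = v
mergeLevel (suc i) zero = 0
mergeLevel (suc i) (suc v) = suc (mergeLevel i v)

splitLevel : ℕ → ℕ → Bool → ℕ
splitLevel zero zero hi = bit hi
splitLevel zero (suc w) hi = suc (suc w)
splitLevel (suc i) zero hi = 0
splitLevel (suc i) (suc w) hi = suc (splitLevel i w hi)

mergeContent : ℕ → (ℕ → ℕ) → ℕ → ℕ
mergeContent zero α zero = α 0 + α 1
mergeContent zero α (suc w) = α (suc (suc w))
mergeContent (suc i) α zero = α 0
mergeContent (suc i) α (suc w) = mergeContent i (λ v → α (suc v)) w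

-- Sets of forbidden-ascent positions are flag functions c : ℕ → Bool.  'dropFlag i'
-- removes position i (shifting later positions down, matching 'mergeLevel i'),
-- 'clearFlag i' unsets it in place, and 'flagCount k c' counts flags below k.
dropFlag : ℕ → (ℕ → Bool) → ℕ → Bool
dropFlag zero c w = c (suc w)
dropFlag (suc i) c zero = c 0
dropFlag (suc i) c (suc w) = dropFlag i (λ v → c (suc v)) w

clearFlag : ℕ → (ℕ → Bool) → ℕ → Bool
clearFlag zero c zero = false
clearFlag zero c (suc w) = c (suc w)
clearFlag (suc i) c zero = c zero
clearFlag (suc i) c (suc w) = clearFlag i (λ v → c (suc v)) w

mergeLevel-≤ : ∀ i v → v ≤ i → mergeLevel i v ≡ v
mergeLevel-≤ zero zero _ = refl
mergeLevel-≤ (suc i) zero _ = refl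
mergeLevel-≤ (suc i) (suc v) (s≤s p) = cong suc (mergeLevel-≤ i v p)

mergeLevel-> : ∀ i v → i ≤ v → mergeLevel i (suc v) ≡ v
mergeLevel-> zero v _ = refl
mergeLevel-> (suc i) (suc v) (s≤s p) = cong suc (mergeLevel-> i v p)

mergeLevel-mono : ∀ i {u v} → u ≤ v → mergeLevel i u ≤ mergeLevel i v
mergeLevel-mono zero {zero} {v} p = z≤n
mergeLevel-mono zero {suc u} {suc v} (s≤s p) = p
mergeLevel-mono (suc i) {zero} {v} p = z≤n
mergeLevel-mono (suc i) {suc u} {suc v} (s≤s p) = s≤s (mergeLevel-mono i p)

splitLevel-mono : ∀ i w w' hi hi' → w ≤ w' → (w ≡ w' → w ≡ i → hi ≡ true → hi' ≡ true) →
  splitLevel i w hi ≤ splitLevel i w' hi'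
splitLevel-mono zero zero zero false hi' p h = z≤n
splitLevel-mono zero zero zero true false p h = ⊥-elim (false≢true (h refl refl refl))
splitLevel-mono zero zero zero true true p h = ≤-refl
splitLevel-mono zero zero (suc w') false hi' p h = z≤n
splitLevel-mono zero zero (suc w') true hi' p h = s≤s z≤n
splitLevel-mono zero (suc w) (suc w') hi hi' (s≤s p) h = s≤s (s≤s p)
splitLevel-mono (suc i) zero w' hi hi' p h = z≤n
splitLevel-mono (suc i) (suc w) (suc w') hi hi' (s≤s p) h =
  s≤s (splitLevel-mono i w w' hi hi' p (λ e1 e2 → h (cong suc e1) (cong suc e2)))

mergeLevel-inv< : ∀ i v w → mergeLevel i v ≡ w → w < i → v ≡ w
mergeLevel-inv< zero v w e ()
mergeLevel-inv< (suc i) zero w e p = e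
mergeLevel-inv< (suc i) (suc v) zero () p
mergeLevel-inv< (suc i) (suc v) (suc w) e (s≤s p) = cong suc (mergeLevel-inv< i v w (suc-injective e) p)

mergeLevel-inv≡ : ∀ i v → mergeLevel i v ≡ i → v ≡ i ⊎ v ≡ suc i
mergeLevel-inv≡ zero zero e = inj₁ refl
mergeLevel-inv≡ zero (suc v) e = inj₂ (cong suc e)
mergeLevel-inv≡ (suc i) zero ()
mergeLevel-inv≡ (suc i) (suc v) e with mergeLevel-inv≡ i v (suc-injective e)
... | inj₁ x = inj₁ (cong suc x)
... | inj₂ y = inj₂ (cong suc y)

mergeLevel-inv> : ∀ i v w → mergeLevel i v ≡ w → i < w → v ≡ suc w
mergeLevel-inv> zero zero w e p = ⊥-elim (<⇒≢ p e)
mergeLevel-inv> zero (suc v) w e p = cong suc e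
mergeLevel-inv> (suc i) zero w e p = ⊥-elim (<⇒≢ (≤-trans (s≤s z≤n) p) e)
mergeLevel-inv> (suc i) (suc v) zero e ()
mergeLevel-inv> (suc i) (suc v) (suc w) e (s≤s p) = cong suc (mergeLevel-inv> i v w (suc-injective e) p)

mergeLevel-bound : ∀ i v k → i < suc k → v < suc (suc k) → mergeLevel i v < suc k
mergeLevel-bound zero zero k p q = s≤s z≤n
mergeLevel-bound zero (suc v) k p (s≤s q) = q
mergeLevel-bound (suc i) zero k p q = s≤s z≤n
mergeLevel-bound (suc i) (suc v) zero (s≤s ()) q
mergeLevel-bound (suc i) (suc v) (suc k) (s≤s p) (s≤s q) = s≤s (mergeLevel-bound i v k p q)

splitLevel-bound : ∀ i w hi k → i < suc k → w < suc k → splitLevel i w hi < suc (suc k)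
splitLevel-bound zero zero false k p q = s≤s z≤n
splitLevel-bound zero zero true k p q = s≤s (s≤s z≤n)
splitLevel-bound zero (suc w) hi k p q = s≤s q
splitLevel-bound (suc i) zero hi k p q = s≤s z≤n
splitLevel-bound (suc i) (suc w) hi zero (s≤s ()) q
splitLevel-bound (suc i) (suc w) hi (suc k) (s≤s p) (s≤s q) = s≤s (splitLevel-bound i w hi k p q)

splitLevel-< : ∀ i w hi → w < i → splitLevel i w hi ≡ w
splitLevel-< zero w hi ()
splitLevel-< (suc i) zero hi p = refl
splitLevel-< (suc i) (suc w) hi (s≤s p) = cong suc (splitLevel-< i w hi p)

splitLevel-≡-low : ∀ i → splitLevel i i false ≡ i
splitLevel-≡-low zero = refl
splitLevel-≡-low (suc i) = cong suc (splitLevel-≡-low i)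

splitLevel-≡-high : ∀ i → splitLevel i i true ≡ suc i
splitLevel-≡-high zero = refl
splitLevel-≡-high (suc i) = cong suc (splitLevel-≡-high i)

splitLevel-> : ∀ i w hi → i < w → splitLevel i w hi ≡ suc w
splitLevel-> zero (suc w) hi p = refl
splitLevel-> (suc i) (suc w) hi (s≤s p) = cong suc (splitLevel-> i w hi p)

mergeLevel-splitLevel : ∀ i w hi → mergeLevel i (splitLevel i w hi) ≡ w
mergeLevel-splitLevel zero zero false = refl
mergeLevel-splitLevel zero zero true = refl
mergeLevel-splitLevel zero (suc w) hi = refl
mergeLevel-splitLevel (suc i) zero hi = refl
mergeLevel-splitLevel (suc i) (suc w) hi = cong suc (mergeLevel-splitLevel i w hi)

splitLevel-inv : ∀ i w hi → splitLevel i w hi ≡ i → w ≡ i × hi ≡ false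
splitLevel-inv zero zero false e = refl , refl
splitLevel-inv zero zero true ()
splitLevel-inv zero (suc w) hi ()
splitLevel-inv (suc i) zero hi ()
splitLevel-inv (suc i) (suc w) hi e with splitLevel-inv i w hi (suc-injective e)
... | a , b = cong suc a , b

splitLevel-inv-suc : ∀ i w hi → splitLevel i w hi ≡ suc i → w ≡ i × hi ≡ true
splitLevel-inv-suc zero zero false ()
splitLevel-inv-suc zero zero true e = refl , refl
splitLevel-inv-suc zero (suc w) hi ()
splitLevel-inv-suc (suc i) zero hi ()
splitLevel-inv-suc (suc i) (suc w) hi e with splitLevel-inv-suc i w hi (suc-injective e)
... | a , b = cong suc a , b

mergeContent-< : ∀ i α w → w < i → mergeContent i α w ≡ α w
mergeContent-< zero α w ()
mergeContent-< (suc i) α zero p = refl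
mergeContent-< (suc i) α (suc w) (s≤s p) = mergeContent-< i (λ v → α (suc v)) w p

mergeContent-≡ : ∀ i α → mergeContent i α i ≡ α i + α (suc i)
mergeContent-≡ zero α = refl
mergeContent-≡ (suc i) α = mergeContent-≡ i (λ v → α (suc v))

mergeContent-> : ∀ i α w → i < w → mergeContent i α w ≡ α (suc w)
mergeContent-> zero α (suc w) p = refl
mergeContent-> (suc i) α (suc w) (s≤s p) = mergeContent-> i (λ v → α (suc v)) w p

mergeContent-lower : ∀ i α w → w ≤ i → α w ≤ mergeContent i α w
mergeContent-lower i α w w≤i with m≤n⇒m<n∨m≡n w≤i
... | inj₁ w<i  = ≤-reflexive (sym (mergeContent-< i α w w<i))
... | inj₂ refl = ≤-trans (m≤m+n (α w) (α (suc w))) (≤-reflexive (sym (mergeContent-≡ w α)))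

mergeContent-upper : ∀ i α w → i ≤ w → α (suc w) ≤ mergeContent i α w
mergeContent-upper i α w i≤w with m≤n⇒m<n∨m≡n i≤w
... | inj₁ i<w  = ≤-reflexive (sym (mergeContent-> i α w i<w))
... | inj₂ refl = ≤-trans (m≤n+m (α (suc i)) (α i)) (≤-reflexive (sym (mergeContent-≡ i α)))

dropFlag-< : ∀ i c w → w < i → dropFlag i c w ≡ c w
dropFlag-< zero c w ()
dropFlag-< (suc i) c zero p = refl
dropFlag-< (suc i) c (suc w) (s≤s p) = dropFlag-< i (λ v → c (suc v)) w p

dropFlag-≥ : ∀ i c w → i ≤ w → dropFlag i c w ≡ c (suc w)
dropFlag-≥ zero c w p = refl
dropFlag-≥ (suc i) c (suc w) (s≤s p) = dropFlag-≥ i (λ v → c (suc v)) w p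

clearFlag-≡ : ∀ i c → clearFlag i c i ≡ false
clearFlag-≡ zero c = refl
clearFlag-≡ (suc i) c = clearFlag-≡ i (λ v → c (suc v))

clearFlag-≢ : ∀ i c w → w ≢ i → clearFlag i c w ≡ c w
clearFlag-≢ zero c zero p = ⊥-elim (p refl)
clearFlag-≢ zero c (suc w) p = refl
clearFlag-≢ (suc i) c zero p = refl
clearFlag-≢ (suc i) c (suc w) p = clearFlag-≢ i (λ v → c (suc v)) w (λ e → p (cong suc e))

flagCount : ℕ → (ℕ → Bool) → ℕ
flagCount zero c = 0
flagCount (suc k) c = bit (c 0) + flagCount k (λ v → c (suc v))

flagCount-clear : ∀ k i c → i < k → c i ≡ true → suc (flagCount k (clearFlag i c)) ≡ flagCount k c
flagCount-clear (suc k) zero c p e rewrite e = refl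
flagCount-clear (suc k) (suc i) c (s≤s p) e =
  trans (sym (+-suc (bit (c 0)) _)) (cong (bit (c 0) +_) (flagCount-clear k i (λ v → c (suc v)) p e))

flagCount-drop : ∀ k i c → i < suc k → c i ≡ true → suc (flagCount k (dropFlag i c)) ≡ flagCount (suc k) c
flagCount-drop k zero c p e rewrite e = refl
flagCount-drop zero (suc i) c (s≤s ()) e
flagCount-drop (suc k) (suc i) c (s≤s p) e =
  trans (sym (+-suc (bit (c 0)) _)) (cong (bit (c 0) +_) (flagCount-drop k i (λ v → c (suc v)) p e))

flagCount-suc : ∀ k c t → flagCount k c ≡ suc t → ∃ λ i → i < k × c i ≡ true
flagCount-suc zero c t ()
flagCount-suc (suc k) c t e with c 0 in eq
... | true = 0 , s≤s z≤n , eq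
... | false with flagCount-suc k (λ v → c (suc v)) t e
... | i , p , q = suc i , s≤s p , q

flagCount-zero : ∀ k c → flagCount k c ≡ 0 → ∀ w → w < k → c w ≡ false
flagCount-zero (suc k) c e w w<k with c 0 in eq
flagCount-zero (suc k) c () w w<k | true
flagCount-zero (suc k) c e zero w<k | false = eq
flagCount-zero (suc k) c e (suc w) (s≤s w<k) | false = flagCount-zero k (λ v → c (suc v)) e w w<k

-- A content α is good for the flags c below k if both levels around every flag
-- are nonempty; the merge recurrence needs this to transfer ascents between a
-- map and its merge.
Good : ℕ → (ℕ → ℕ) → (ℕ → Bool) → Set
Good k α c = ∀ w → w < k → c w ≡ true → 0 < α w × 0 < α (suc w)

good-clearFlag : ∀ k α c i → Good k α c → Good k α (clearFlag i c)
good-clearFlag k α c i good w w<k flag with w ≟ i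
... | yes refl = ⊥-elim (false≢true (trans (sym (clearFlag-≡ i c)) flag))
... | no  w≢i  = good w w<k (trans (sym (clearFlag-≢ i c w w≢i)) flag)

good-dropFlag : ∀ k α c i → Good (suc k) α c → i < suc k → Good k (mergeContent i α) (dropFlag i c)
good-dropFlag k α c i good i<k w w<k flag with w <? i
... | yes w<i = let (a , b) = good w (m≤n⇒m≤1+n w<k) (trans (sym (dropFlag-< i c w w<i)) flag)
                in <-≤-trans a (mergeContent-lower i α w (<⇒≤ w<i)) , <-≤-trans b (mergeContent-lower i α (suc w) w<i)
... | no  w≮i = let (a , b) = good (suc w) (s≤s w<k) (trans (sym (dropFlag-≥ i c w (≮⇒≥ w≮i))) flag)
                in <-≤-trans a (mergeContent-upper i α w (≮⇒≥ w≮i)) ,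
                   <-≤-trans b (mergeContent-upper i α (suc w) (m≤n⇒m≤1+n (≮⇒≥ w≮i)))

-- A map σ : P → [K] is a
-- vector of levels; 'fiber σ v' is the size of level v.  σ has an ascent at level i
-- when every element of level i has a smaller label than every element of level
-- i+1.  'admissible k α c' counts the P-partitions into k+1 levels with content α
-- and no ascent at any level w < k flagged by c; with no flag set it is a
-- coefficient of K_P.
module PPartitions {n : ℕ} (P : NLPoset n) where
  open NLPoset P

  level : ∀ {K} → Vec (Fin K) n → Fin n → ℕ
  level σ x = toℕ (lookup σ x)

  fiber : ∀ {K} → Vec (Fin K) n → ℕ → ℕ
  fiber σ v = count (λ x → level σ x ≟ v) (allFin n)

  Ascent : ∀ {K} → Vec (Fin K) n → ℕ → Set
  Ascent σ i = ∀ x y → level σ x ≡ i → level σ y ≡ suc i → toℕ x < toℕ y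

  Ascent? : ∀ {K} (σ : Vec (Fin K) n) i → Dec (Ascent σ i)
  Ascent? σ i = all? λ x → all? λ y → (level σ x ≟ i) →-dec ((level σ y ≟ suc i) →-dec (toℕ x <? toℕ y))

  Content : ∀ {K} → Vec (Fin K) n → (ℕ → ℕ) → Set
  Content {K} σ α = ∀ (w : Fin K) → fiber σ (toℕ w) ≡ α (toℕ w)

  Content? : ∀ {K} (σ : Vec (Fin K) n) α → Dec (Content σ α)
  Content? σ α = all? λ w → fiber σ (toℕ w) ≟ α (toℕ w)

  NoAscentAt : ℕ → ∀ {K} → Vec (Fin K) n → (ℕ → Bool) → Set
  NoAscentAt k σ c = ∀ (w : Fin k) → c (toℕ w) ≡ true → ¬ Ascent σ (toℕ w)

  NoAscentAt? : ∀ k {K} (σ : Vec (Fin K) n) c → Dec (NoAscentAt k σ c)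
  NoAscentAt? k σ c = all? λ w → (c (toℕ w) Bool.≟ true) →-dec ¬? (Ascent? σ (toℕ w))

  Admissible : (k : ℕ) → (ℕ → ℕ) → (ℕ → Bool) → Vec (Fin (suc k)) n → Set
  Admissible k α c σ = IsPPartition P σ × Content σ α × NoAscentAt k σ c

  Admissible? : ∀ k α c (σ : Vec (Fin (suc k)) n) → Dec (Admissible k α c σ)
  Admissible? k α c σ = isPPartition? P σ ×-dec Content? σ α ×-dec NoAscentAt? k σ c

  admissible : (k : ℕ) → (ℕ → ℕ) → (ℕ → Bool) → ℕ
  admissible k α c = count (Admissible? k α c) (allMaps n (suc k))

  content⇒ : ∀ {K} {σ : Vec (Fin K) n} {α} → Content σ α → ∀ v → v < K → fiber σ v ≡ α v
  content⇒ {σ = σ} {α} h v v<K = subst (λ t → fiber σ t ≡ α t) (toℕ-fromℕ< v<K) (h (fromℕ< v<K))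

  ⇒content : ∀ {K} {σ : Vec (Fin K) n} {α} → (∀ v → v < K → fiber σ v ≡ α v) → Content σ α
  ⇒content h w = h (toℕ w) (toℕ<n w)

  noAscentAt⇒ : ∀ {k K} {σ : Vec (Fin K) n} {c} → NoAscentAt k σ c → ∀ v → v < k → c v ≡ true → ¬ Ascent σ v
  noAscentAt⇒ {σ = σ} {c} h v v<k = subst (λ t → c t ≡ true → ¬ Ascent σ t) (toℕ-fromℕ< v<k) (h (fromℕ< v<k))

  ⇒noAscentAt : ∀ {k K} {σ : Vec (Fin K) n} {c} → (∀ v → v < k → c v ≡ true → ¬ Ascent σ v) → NoAscentAt k σ c
  ⇒noAscentAt h w = h (toℕ w) (toℕ<n w)

  admissible-unflagged : ∀ k α c → (∀ w → w < k → c w ≡ false) →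
    admissible k α c ≡ coeffK P (suc k) (λ w → α (toℕ w))
  admissible-unflagged k α c unflagged = count-ext _ _
    (λ σ (pp , cn , _) → pp , λ w → trans (fiberSize≡fiber σ w) (cn w))
    (λ σ (pp , cn) → pp , (λ w → trans (sym (fiberSize≡fiber σ w)) (cn w)) ,
                     λ w flag → ⊥-elim (false≢true (trans (sym (unflagged (toℕ w) (toℕ<n w))) flag)))
    (allMaps n (suc k))
    where
    fiberSize≡fiber : ∀ {K} (σ : Vec (Fin K) n) w → fiberSize P σ w ≡ fiber σ (toℕ w)
    fiberSize≡fiber σ w = count-ext _ _ (λ x e → cong toℕ e) (λ x e → toℕ-injective e) (allFin n)

  module Merged {K K' : ℕ} (σ : Vec (Fin K) n) (τ : Vec (Fin K') n) (i : ℕ)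
                (merged : ∀ x → level τ x ≡ mergeLevel i (level σ x)) where

    level-merged : ∀ {x v} → level σ x ≡ v → level τ x ≡ mergeLevel i v
    level-merged {x} e = trans (merged x) (cong (mergeLevel i) e)

    fiber-merged-< : ∀ w → w < i → fiber τ w ≡ fiber σ w
    fiber-merged-< w w<i = count-ext _ _
      (λ x e → mergeLevel-inv< i (level σ x) w (trans (sym (merged x)) e) w<i)
      (λ x e → trans (level-merged e) (mergeLevel-≤ i w (<⇒≤ w<i))) (allFin n)

    fiber-merged-≡ : fiber τ i ≡ fiber σ i + fiber σ (suc i)
    fiber-merged-≡ = trans (count-split (λ x → level τ x ≟ i) (λ x → level σ x ≟ i) (allFin n))
                           (cong₂ _+_ from-level-i from-level-suc-i)
      where
      from-level-i : count (λ x → (level τ x ≟ i) ×-dec (level σ x ≟ i)) (allFin n) ≡ fiber σ i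
      from-level-i = count-ext _ _ (λ x (_ , e) → e)
        (λ x e → trans (level-merged e) (mergeLevel-≤ i i ≤-refl) , e) (allFin n)
      upper : ∀ x → level τ x ≡ i → level σ x ≢ i → level σ x ≡ suc i
      upper x e ne with mergeLevel-inv≡ i (level σ x) (trans (sym (merged x)) e)
      ... | inj₁ e' = ⊥-elim (ne e')
      ... | inj₂ e' = e'
      from-level-suc-i : count (λ x → (level τ x ≟ i) ×-dec ¬? (level σ x ≟ i)) (allFin n) ≡ fiber σ (suc i)
      from-level-suc-i = count-ext _ _ (λ x (e , ne) → upper x e ne)
        (λ x e → trans (level-merged e) (mergeLevel-> i i ≤-refl) , λ e' → <-irrefl (trans (sym e') e) (n<1+n i))
        (allFin n)

    fiber-merged-> : ∀ w → i < w → fiber τ w ≡ fiber σ (suc w)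
    fiber-merged-> w i<w = count-ext _ _
      (λ x e → mergeLevel-inv> i (level σ x) w (trans (sym (merged x)) e) i<w)
      (λ x e → trans (level-merged e) (mergeLevel-> i w (<⇒≤ i<w))) (allFin n)

    merged-isPPartition : IsPPartition P σ → IsPPartition P τ
    merged-isPPartition pp x y x≼y = subst₂ _≤_ (sym (merged x)) (sym (merged y)) (mergeLevel-mono i (pp x y x≼y))

    ascent-below⇐ : ∀ w → w < i → Ascent τ w → Ascent σ w
    ascent-below⇐ w w<i asc x y ex ey =
      asc x y (trans (level-merged ex) (mergeLevel-≤ i w (<⇒≤ w<i))) (trans (level-merged ey) (mergeLevel-≤ i (suc w) w<i))

    ascent-above⇐ : ∀ w → i ≤ w → Ascent τ w → Ascent σ (suc w)
    ascent-above⇐ w i≤w asc x y ex ey =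
      asc x y (trans (level-merged ex) (mergeLevel-> i w i≤w)) (trans (level-merged ey) (mergeLevel-> i (suc w) (m≤n⇒m≤1+n i≤w)))

    -- ... and conversely, when σ has an ascent at i: next to the merged level,
    -- ascents pass through a nonempty level i or i+1 by transitivity.
    module _ (ascent-i : Ascent σ i) where

      ascent-below⇒ : ∀ w → w < i → (∃ λ z → level σ z ≡ i) → Ascent σ w → Ascent τ w
      ascent-below⇒ w w<i (z , ez) asc x y ex ey with mergeLevel-inv< i (level σ x) w (trans (sym (merged x)) ex) w<i | suc w <? i
      ... | σx | yes sw<i = asc x y σx (mergeLevel-inv< i (level σ y) (suc w) (trans (sym (merged y)) ey) sw<i)
      ... | σx | no  sw≮i with ≤-antisym w<i (≮⇒≥ sw≮i)
      ... | refl with mergeLevel-inv≡ (suc w) (level σ y) (trans (sym (merged y)) ey)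
      ... | inj₁ σy = asc x y σx σy
      ... | inj₂ σy = <-trans (asc x z σx ez) (ascent-i z y ez σy)

      ascent-above⇒ : ∀ w → i ≤ w → (∃ λ z → level σ z ≡ suc i) → Ascent σ (suc w) → Ascent τ w
      ascent-above⇒ w i≤w (z , ez) asc x y ex ey with mergeLevel-inv> i (level σ y) (suc w) (trans (sym (merged y)) ey) (s≤s i≤w) | i <? w
      ... | σy | yes i<w = asc x y (mergeLevel-inv> i (level σ x) w (trans (sym (merged x)) ex) i<w) σy
      ... | σy | no  i≮w with ≤-antisym i≤w (≮⇒≥ i≮w)
      ... | refl with mergeLevel-inv≡ i (level σ x) (trans (sym (merged x)) ex)
      ... | inj₂ σx = asc x y σx σy
      ... | inj₁ σx = <-trans (ascent-i x z σx ez) (asc z y ez σy)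

      module _ (k : ℕ) (i<k : i < suc k) (c : ℕ → Bool) where

        merged-noAscentAt : NoAscentAt (suc k) σ (clearFlag i c) → NoAscentAt k τ (dropFlag i c)
        merged-noAscentAt noAsc = ⇒noAscentAt {σ = τ} {c = dropFlag i c} avoid
          where
          avoid : ∀ v → v < k → dropFlag i c v ≡ true → ¬ Ascent τ v
          avoid v v<k flag with v <? i
          ... | yes v<i = λ asc → noAscentAt⇒ {σ = σ} {c = clearFlag i c} noAsc v (m≤n⇒m≤1+n v<k)
                 (trans (clearFlag-≢ i c v (<⇒≢ v<i)) (trans (sym (dropFlag-< i c v v<i)) flag)) (ascent-below⇐ v v<i asc)
          ... | no  v≮i = λ asc → noAscentAt⇒ {σ = σ} {c = clearFlag i c} noAsc (suc v) (s≤s v<k)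
                 (trans (clearFlag-≢ i c (suc v) (λ e → <-irrefl (sym e) (s≤s (≮⇒≥ v≮i))))
                        (trans (sym (dropFlag-≥ i c v (≮⇒≥ v≮i))) flag)) (ascent-above⇐ v (≮⇒≥ v≮i) asc)

        unmerged-noAscentAt : (∃ λ z → level σ z ≡ i) → (∃ λ z → level σ z ≡ suc i) →
          NoAscentAt k τ (dropFlag i c) → NoAscentAt (suc k) σ (clearFlag i c)
        unmerged-noAscentAt low high noAsc = ⇒noAscentAt {σ = σ} {c = clearFlag i c} avoid
          where
          avoid : ∀ v → v < suc k → clearFlag i c v ≡ true → ¬ Ascent σ v
          avoid v v<k flag with <-cmp v i
          ... | tri≈ _ refl _ = ⊥-elim (false≢true (trans (sym (clearFlag-≡ i c)) flag))
          ... | tri< v<i _ _ = λ asc → noAscentAt⇒ {σ = τ} {c = dropFlag i c} noAsc v (<-≤-trans v<i (≤-pred i<k))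
                 (trans (dropFlag-< i c v v<i) (trans (sym (clearFlag-≢ i c v (<⇒≢ v<i))) flag)) (ascent-below⇒ v v<i low asc)
          avoid (suc u) v<k flag | tri> _ _ i<v = λ asc → noAscentAt⇒ {σ = τ} {c = dropFlag i c} noAsc u (≤-pred v<k)
                 (trans (dropFlag-≥ i c u (≤-pred i<v)) (trans (sym (clearFlag-≢ i c (suc u) (λ e → <-irrefl (sym e) i<v))) flag))
                 (ascent-above⇒ u (≤-pred i<v) high asc)

  -- The merge recurrence at a set flag i, for a good content α:
  --   admissible (k+1) α c + admissible k (mergeContent i α) (dropFlag i c)
  --     = admissible (k+1) α (clearFlag i c).
  -- A map counted on the right either has no ascent at i (the first term) or has
  -- one; merging the levels i and i+1 is a bijection from the latter maps onto
  -- those of the second term, whose inverse splits the merged level by sending its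
  -- α i smallest labels to level i.
  module Recurrence (k i : ℕ) (i<k : i < suc k) (α : ℕ → ℕ) (c : ℕ → Bool)
                    (flag-i : c i ≡ true) (good : Good (suc k) α c) where

    mergeMap : Vec (Fin (suc (suc k))) n → Vec (Fin (suc k)) n
    mergeMap σ = Vec.map (λ v → fromℕ< (mergeLevel-bound i (toℕ v) k i<k (toℕ<n v))) σ

    mergeMap-level : ∀ σ x → level (mergeMap σ) x ≡ mergeLevel i (level σ x)
    mergeMap-level σ x = trans (cong toℕ (lookup-map x _ σ)) (toℕ-fromℕ< _)

    atLevel? : ∀ {K} (τ : Vec (Fin K) n) y → Dec (level τ y ≡ i)
    atLevel? τ y = level τ y ≟ i

    goesUp : Vec (Fin (suc k)) n → Fin n → Bool
    goesUp τ x = does (α i ≤? rank (atLevel? τ) x)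

    splitMap : Vec (Fin (suc k)) n → Vec (Fin (suc (suc k))) n
    splitMap τ = Vec.tabulate (λ x → fromℕ< (splitLevel-bound i (level τ x) (goesUp τ x) k i<k (toℕ<n (lookup τ x))))

    splitMap-level : ∀ τ x → level (splitMap τ) x ≡ splitLevel i (level τ x) (goesUp τ x)
    splitMap-level τ x = trans (cong toℕ (lookup∘tabulate _ x)) (toℕ-fromℕ< _)

    splitMap-merges : ∀ τ x → level τ x ≡ mergeLevel i (level (splitMap τ) x)
    splitMap-merges τ x = sym (trans (cong (mergeLevel i) (splitMap-level τ x)) (mergeLevel-splitLevel i _ _))

    merge∘split : ∀ τ → mergeMap (splitMap τ) ≡ τ
    merge∘split τ = vec-ext _ _ λ x → toℕ-injective (trans (mergeMap-level (splitMap τ) x) (sym (splitMap-merges τ x)))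

    splitMap-low⇔ : ∀ τ x → level (splitMap τ) x ≡ i ⇔ (level τ x ≡ i × rank (atLevel? τ) x < α i)
    splitMap-low⇔ τ x = mk⇔ to from
      where
      to : level (splitMap τ) x ≡ i → level τ x ≡ i × rank (atLevel? τ) x < α i
      to e with splitLevel-inv i (level τ x) (goesUp τ x) (trans (sym (splitMap-level τ x)) e)
      ... | τx , down = τx , ≰⇒> (does-false⇒ (α i ≤? rank (atLevel? τ) x) down)
      from : level τ x ≡ i × rank (atLevel? τ) x < α i → level (splitMap τ) x ≡ i
      from (τx , r<) = trans (splitMap-level τ x)
        (trans (cong₂ (splitLevel i) τx (dec-false (α i ≤? rank (atLevel? τ) x) (<⇒≱ r<))) (splitLevel-≡-low i))

    splitMap-high⇔ : ∀ τ x → level (splitMap τ) x ≡ suc i ⇔ (level τ x ≡ i × ¬ rank (atLevel? τ) x < α i)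
    splitMap-high⇔ τ x = mk⇔ to from
      where
      to : level (splitMap τ) x ≡ suc i → level τ x ≡ i × ¬ rank (atLevel? τ) x < α i
      to e with splitLevel-inv-suc i (level τ x) (goesUp τ x) (trans (sym (splitMap-level τ x)) e)
      ... | τx , up = τx , ≤⇒≯ (does-true⇒ (α i ≤? rank (atLevel? τ) x) up)
      from : level τ x ≡ i × ¬ rank (atLevel? τ) x < α i → level (splitMap τ) x ≡ suc i
      from (τx , r≮) = trans (splitMap-level τ x)
        (trans (cong₂ (splitLevel i) τx (dec-true (α i ≤? rank (atLevel? τ) x) (≮⇒≥ r≮))) (splitLevel-≡-high i))

    splitMap-ascent : ∀ τ → Ascent (splitMap τ) i
    splitMap-ascent τ x y ex ey =
      rank-inv (atLevel? τ) x y (<-≤-trans (proj₂ (Equivalence.to (splitMap-low⇔ τ x) ex))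
                                           (≮⇒≥ (proj₂ (Equivalence.to (splitMap-high⇔ τ y) ey))))

    splitMap-isPPartition : ∀ τ → IsPPartition P τ → IsPPartition P (splitMap τ)
    splitMap-isPPartition τ pp x y x≼y =
      subst₂ _≤_ (sym (splitMap-level τ x)) (sym (splitMap-level τ y))
        (splitLevel-mono i (level τ x) (level τ y) (goesUp τ x) (goesUp τ y) (pp x y x≼y) up-closed)
      where
      up-closed : level τ x ≡ level τ y → level τ x ≡ i → goesUp τ x ≡ true → goesUp τ y ≡ true
      up-closed _ _ up = dec-true (α i ≤? rank (atLevel? τ) y)
        (≤-trans (does-true⇒ (α i ≤? rank (atLevel? τ) x) up) (rank-mono (atLevel? τ) x y (natural x≼y)))

    mergeMap-content : ∀ σ → Content σ α → Content (mergeMap σ) (mergeContent i α)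
    mergeMap-content σ cn = ⇒content {σ = mergeMap σ} {α = mergeContent i α} fibers
      where
      open Merged σ (mergeMap σ) i (mergeMap-level σ)
      α-σ : ∀ v → v < suc (suc k) → fiber σ v ≡ α v
      α-σ = content⇒ {σ = σ} {α = α} cn
      fibers : ∀ v → v < suc k → fiber (mergeMap σ) v ≡ mergeContent i α v
      fibers v v<k with <-cmp v i
      ... | tri< v<i _ _ = trans (fiber-merged-< v v<i) (trans (α-σ v (m≤n⇒m≤1+n v<k)) (sym (mergeContent-< i α v v<i)))
      ... | tri≈ _ refl _ = trans fiber-merged-≡
              (trans (cong₂ _+_ (α-σ i (m≤n⇒m≤1+n i<k)) (α-σ (suc i) (s≤s i<k))) (sym (mergeContent-≡ i α)))
      ... | tri> _ _ i<v = trans (fiber-merged-> v i<v) (trans (α-σ (suc v) (s≤s v<k)) (sym (mergeContent-> i α v i<v)))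

    splitMap-content : ∀ τ → Content τ (mergeContent i α) → Content (splitMap τ) α
    splitMap-content τ cn = ⇒content {σ = splitMap τ} {α = α} fibers
      where
      open Merged (splitMap τ) τ i (splitMap-merges τ)
      α-τ : ∀ v → v < suc k → fiber τ v ≡ mergeContent i α v
      α-τ = content⇒ {σ = τ} {α = mergeContent i α} cn
      merged-size : count (atLevel? τ) (allFin n) ≡ α i + α (suc i)
      merged-size = trans (α-τ i i<k) (mergeContent-≡ i α)
      lowRank? : ∀ x → Dec (level τ x ≡ i × rank (atLevel? τ) x < α i)
      lowRank? x = atLevel? τ x ×-dec (rank (atLevel? τ) x <? α i)
      highRank? : ∀ x → Dec (level τ x ≡ i × ¬ rank (atLevel? τ) x < α i)
      highRank? x = atLevel? τ x ×-dec ¬? (rank (atLevel? τ) x <? α i)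
      lowCount : count lowRank? (allFin n) ≡ α i
      lowCount = count-rank< n (atLevel? τ) (α i) (subst (α i ≤_) (sym merged-size) (m≤m+n (α i) (α (suc i))))
      low : fiber (splitMap τ) i ≡ α i
      low = trans (count-ext _ lowRank? (λ x → Equivalence.to (splitMap-low⇔ τ x))
                                        (λ x → Equivalence.from (splitMap-low⇔ τ x)) (allFin n)) lowCount
      high : fiber (splitMap τ) (suc i) ≡ α (suc i)
      high = +-cancelˡ-≡ (α i) _ _ (begin
        α i + fiber (splitMap τ) (suc i)
          ≡⟨ cong₂ _+_ (sym lowCount) (count-ext _ highRank? (λ x → Equivalence.to (splitMap-high⇔ τ x))
                                                            (λ x → Equivalence.from (splitMap-high⇔ τ x)) (allFin n)) ⟩
        count lowRank? (allFin n) + count highRank? (allFin n)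
          ≡⟨ sym (count-split (atLevel? τ) (λ x → rank (atLevel? τ) x <? α i) (allFin n)) ⟩
        count (atLevel? τ) (allFin n)
          ≡⟨ merged-size ⟩
        α i + α (suc i) ∎)
        where open ≡-Reasoning
      fibers : ∀ v → v < suc (suc k) → fiber (splitMap τ) v ≡ α v
      fibers v v<k with <-cmp v i
      ... | tri< v<i _ _ = trans (sym (fiber-merged-< v v<i)) (trans (α-τ v (<-trans v<i i<k)) (mergeContent-< i α v v<i))
      ... | tri≈ _ refl _ = low
      fibers (suc u) v<k | tri> _ _ i<v with m≤n⇒m<n∨m≡n (≤-pred i<v)
      ... | inj₂ refl = high
      ... | inj₁ i<u = trans (sym (fiber-merged-> u i<u)) (trans (α-τ u (≤-pred v<k)) (mergeContent-> i α u i<u))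

    -- On a map σ with an ascent at i and content α, the elements of level i are
    -- exactly the α i lowest-ranked elements of the merged level, so splitting
    -- undoes merging.
    module _ (σ : Vec (Fin (suc (suc k))) n) (ascent-i : Ascent σ i) (cn : Content σ α) where
      private
        τ : Vec (Fin (suc k)) n
        τ = mergeMap σ
        open Merged σ τ i (mergeMap-level σ)
        size-i : count (atLevel? σ) (allFin n) ≡ α i
        size-i = content⇒ {σ = σ} {α = α} cn i (m≤n⇒m≤1+n i<k)

      -- Below a level-i element, the merged level contains only level-i elements.
      rank-low : ∀ x → level σ x ≡ i → rank (atLevel? τ) x < α i
      rank-low x σx = subst₂ _<_ (sym same-rank) size-i (rank<size (atLevel? σ) x σx)
        where
        only-level-i : ∀ y → level τ y ≡ i → toℕ y < toℕ x → level σ y ≡ i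
        only-level-i y τy y<x with mergeLevel-inv≡ i (level σ y) (trans (sym (mergeMap-level σ y)) τy)
        ... | inj₁ σy = σy
        ... | inj₂ σy = ⊥-elim (<-asym y<x (ascent-i x y σx σy))
        same-rank : rank (atLevel? τ) x ≡ rank (atLevel? σ) x
        same-rank = count-ext _ _ (λ y (τy , y<x) → only-level-i y τy y<x , y<x)
          (λ y (σy , y<x) → trans (level-merged σy) (mergeLevel-≤ i i ≤-refl) , y<x) (allFin n)

      -- Below a level-(i+1) element lie all level-i elements.
      rank-high : ∀ x → level σ x ≡ suc i → α i ≤ rank (atLevel? τ) x
      rank-high x σx = subst (_≤ rank (atLevel? τ) x) size-i
        (count-mono (atLevel? σ) (λ y → atLevel? τ y ×-dec (toℕ y <? toℕ x))
          (λ y σy → trans (level-merged σy) (mergeLevel-≤ i i ≤-refl) , ascent-i y x σy σx) (allFin n))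

      split∘merge : splitMap τ ≡ σ
      split∘merge = vec-ext _ _ λ x → toℕ-injective (trans (splitMap-level τ x) (restore x (level σ x) refl))
        where
        restore : ∀ x v → level σ x ≡ v → splitLevel i (level τ x) (goesUp τ x) ≡ v
        restore x v σx with <-cmp v i
        ... | tri< v<i _ _ = trans (cong (λ w → splitLevel i w (goesUp τ x)) (trans (level-merged σx) (mergeLevel-≤ i v (<⇒≤ v<i))))
                                   (splitLevel-< i v _ v<i)
        ... | tri≈ _ refl _ = trans (cong₂ (splitLevel i) (trans (level-merged σx) (mergeLevel-≤ i i ≤-refl))
                                                          (dec-false (α i ≤? rank (atLevel? τ) x) (<⇒≱ (rank-low x σx))))
                                    (splitLevel-≡-low i)
        restore x (suc u) σx | tri> _ _ i<v with m≤n⇒m<n∨m≡n (≤-pred i<v)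
        ... | inj₂ refl = trans (cong₂ (splitLevel i) (trans (level-merged σx) (mergeLevel-> i i ≤-refl))
                                                      (dec-true (α i ≤? rank (atLevel? τ) x) (rank-high x σx)))
                                (splitLevel-≡-high i)
        ... | inj₁ i<u = trans (cong (λ w → splitLevel i w (goesUp τ x)) (trans (level-merged σx) (mergeLevel-> i u (<⇒≤ i<u))))
                               (splitLevel-> i u _ i<u)

    private
      Allowed? : ∀ σ → Dec (Admissible (suc k) α (clearFlag i c) σ)
      Allowed? = Admissible? (suc k) α (clearFlag i c)
      maps : List (Vec (Fin (suc (suc k))) n)
      maps = allMaps n (suc (suc k))

    -- Maps without an ascent at i: the flag at i is then automatically respected.
    count-without-ascent : count (λ σ → Allowed? σ ×-dec ¬? (Ascent? σ i)) maps ≡ admissible (suc k) α c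
    count-without-ascent = count-ext _ _ to from maps
      where
      to : ∀ σ → Admissible (suc k) α (clearFlag i c) σ × ¬ Ascent σ i → Admissible (suc k) α c σ
      to σ ((pp , cn , noAsc) , ¬asc) = pp , cn , ⇒noAscentAt {σ = σ} {c = c} avoid
        where
        avoid : ∀ v → v < suc k → c v ≡ true → ¬ Ascent σ v
        avoid v v<k flag with v ≟ i
        ... | yes refl = ¬asc
        ... | no  v≢i = noAscentAt⇒ {σ = σ} {c = clearFlag i c} noAsc v v<k (trans (clearFlag-≢ i c v v≢i) flag)
      from : ∀ σ → Admissible (suc k) α c σ → Admissible (suc k) α (clearFlag i c) σ × ¬ Ascent σ i
      from σ (pp , cn , noAsc) = (pp , cn , ⇒noAscentAt {σ = σ} {c = clearFlag i c} avoid) ,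
                                 noAscentAt⇒ {σ = σ} {c = c} noAsc i i<k flag-i
        where
        avoid : ∀ v → v < suc k → clearFlag i c v ≡ true → ¬ Ascent σ v
        avoid v v<k flag with v ≟ i
        ... | yes refl = ⊥-elim (false≢true (trans (sym (clearFlag-≡ i c)) flag))
        ... | no  v≢i = noAscentAt⇒ {σ = σ} {c = c} noAsc v v<k (trans (sym (clearFlag-≢ i c v v≢i)) flag)

    count-with-ascent : count (λ σ → Allowed? σ ×-dec Ascent? σ i) maps ≡ admissible k (mergeContent i α) (dropFlag i c)
    count-with-ascent = count-bijection _ _ maps (allMaps n (suc k)) (allMaps-unique n _) (allMaps-unique n _)
      (λ σ _ → allMaps-complete n _ σ) (λ τ _ → allMaps-complete n _ τ) mergeMap splitMap merge-admissible split-admissible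
      (λ σ ((_ , cn , _) , asc) → split∘merge σ asc cn) (λ τ _ → merge∘split τ)
      where
      merge-admissible : ∀ σ → Admissible (suc k) α (clearFlag i c) σ × Ascent σ i →
        Admissible k (mergeContent i α) (dropFlag i c) (mergeMap σ)
      merge-admissible σ ((pp , cn , noAsc) , asc) =
        merged-isPPartition pp , mergeMap-content σ cn , merged-noAscentAt asc k i<k c noAsc
        where open Merged σ (mergeMap σ) i (mergeMap-level σ)
      split-admissible : ∀ τ → Admissible k (mergeContent i α) (dropFlag i c) τ →
        Admissible (suc k) α (clearFlag i c) (splitMap τ) × Ascent (splitMap τ) i
      split-admissible τ (pp , cn , noAsc) =
        (splitMap-isPPartition τ pp , cn' , unmerged-noAscentAt (splitMap-ascent τ) k i<k c low high noAsc) , splitMap-ascent τ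
        where
        open Merged (splitMap τ) τ i (splitMap-merges τ)
        cn' : Content (splitMap τ) α
        cn' = splitMap-content τ cn
        nonempty : ∀ v → v < suc (suc k) → 0 < α v → ∃ λ z → level (splitMap τ) z ≡ v
        nonempty v v<k pos = count-witness (λ x → level (splitMap τ) x ≟ v) (allFin n)
          (subst (0 <_) (sym (content⇒ {σ = splitMap τ} {α = α} cn' v v<k)) pos)
        low : ∃ λ z → level (splitMap τ) z ≡ i
        low = nonempty i (m≤n⇒m≤1+n i<k) (proj₁ (good i i<k flag-i))
        high : ∃ λ z → level (splitMap τ) z ≡ suc i
        high = nonempty (suc i) (s≤s i<k) (proj₂ (good i i<k flag-i))

    admissible-recurrence :
      admissible (suc k) α c + admissible k (mergeContent i α) (dropFlag i c) ≡ admissible (suc k) α (clearFlag i c)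
    admissible-recurrence = begin
      admissible (suc k) α c + admissible k (mergeContent i α) (dropFlag i c)
        ≡⟨ cong₂ _+_ (sym count-without-ascent) (sym count-with-ascent) ⟩
      count (λ σ → Allowed? σ ×-dec ¬? (Ascent? σ i)) maps + count (λ σ → Allowed? σ ×-dec Ascent? σ i) maps
        ≡⟨ +-comm (count (λ σ → Allowed? σ ×-dec ¬? (Ascent? σ i)) maps) _ ⟩
      count (λ σ → Allowed? σ ×-dec Ascent? σ i) maps + count (λ σ → Allowed? σ ×-dec ¬? (Ascent? σ i)) maps
        ≡⟨ sym (count-split Allowed? (λ σ → Ascent? σ i) maps) ⟩
      admissible (suc k) α (clearFlag i c) ∎
      where open ≡-Reasoning

-- By induction on the number of set flags: with none, the counts are
-- coefficients of K; otherwise the merge recurrence at a set flag expresses the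
-- count through counts with one flag fewer.
admissible-determined : ∀ {n} (P Q : NLPoset n) → SameK P Q →
  ∀ k α c → Good k α c → PPartitions.admissible P k α c ≡ PPartitions.admissible Q k α c
admissible-determined P Q sameK k α c good = by-flags (flagCount k c) k α c refl good
  where
  module ℙ = PPartitions P
  module ℚ = PPartitions Q
  by-flags : ∀ t k α c → flagCount k c ≡ t → Good k α c → ℙ.admissible k α c ≡ ℚ.admissible k α c
  by-flags zero k α c none good = begin
    ℙ.admissible k α c                  ≡⟨ ℙ.admissible-unflagged k α c (flagCount-zero k c none) ⟩
    coeffK P (suc k) (λ w → α (toℕ w))  ≡⟨ sameK (suc k) (λ w → α (toℕ w)) ⟩
    coeffK Q (suc k) (λ w → α (toℕ w))  ≡⟨ sym (ℚ.admissible-unflagged k α c (flagCount-zero k c none)) ⟩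
    ℚ.admissible k α c                  ∎
    where open ≡-Reasoning
  by-flags (suc t) k α c flags good with flagCount-suc k c t flags
  by-flags (suc t) (suc k) α c flags good | i , i<k , flag-i = +-cancelʳ-≡ _ _ _ (begin
    ℙ.admissible (suc k) α c + ℙ.admissible k α' c'
      ≡⟨ ℙ.Recurrence.admissible-recurrence k i i<k α c flag-i good ⟩
    ℙ.admissible (suc k) α (clearFlag i c)
      ≡⟨ by-flags t (suc k) α (clearFlag i c) cleared (good-clearFlag (suc k) α c i good) ⟩
    ℚ.admissible (suc k) α (clearFlag i c)
      ≡⟨ sym (ℚ.Recurrence.admissible-recurrence k i i<k α c flag-i good) ⟩
    ℚ.admissible (suc k) α c + ℚ.admissible k α' c'
      ≡⟨ cong (ℚ.admissible (suc k) α c +_) (sym (by-flags t k α' c' dropped (good-dropFlag k α c i good i<k))) ⟩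
    ℚ.admissible (suc k) α c + ℙ.admissible k α' c' ∎)
    where
    open ≡-Reasoning
    α' : ℕ → ℕ
    α' = mergeContent i α
    c' : ℕ → Bool
    c' = dropFlag i c
    cleared : flagCount (suc k) (clearFlag i c) ≡ t
    cleared = suc-injective (trans (flagCount-clear (suc k) i c i<k flag-i) flags)
    dropped : flagCount k c' ≡ t
    dropped = suc-injective (trans (flagCount-drop k i c i<k flag-i) flags)

∈-decided⇔ : ∀ {m} {D : Fin m → Set} (D? : ∀ x → Dec (D x)) x → x ∈ₛ Vec.tabulate (λ y → does (D? y)) ⇔ D x
∈-decided⇔ D? x = mk⇔
  (λ x∈ → does-true⇒ (D? x) (trans (sym (lookup∘tabulate (λ y → does (D? y)) x)) ([]=⇒lookup x∈)))
  (λ d → lookup⇒[]= x (Vec.tabulate (λ y → does (D? y))) (trans (lookup∘tabulate (λ y → does (D? y)) x) (dec-true (D? x) d)))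

subset-ext : ∀ {m} {D : Fin m → Set} (D? : ∀ x → Dec (D x)) {S : Subset m} →
  (∀ x → D x ⇔ x ∈ₛ S) → Vec.tabulate (λ x → does (D? x)) ≡ S
subset-ext {D = D} D? {S} D⇔ = vec-ext _ S λ x → trans (lookup∘tabulate (λ y → does (D? y)) x) (same x (lookup S x) refl)
  where
  same : ∀ x b → lookup S x ≡ b → does (D? x) ≡ b
  same x true  e = dec-true (D? x) (Equivalence.from (D⇔ x) (lookup⇒[]= x S e))
  same x false e = dec-false (D? x) (λ d → false≢true (trans (sym e) ([]=⇒lookup (Equivalence.to (D⇔ x) d))))

size≡count : ∀ {m} (S : Subset m) → ∣ S ∣ ≡ count (_∈? S) (allFin m)
size≡count {zero} []ᵥ = refl
size≡count {suc m} (s ∷ᵥ S) = begin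
  ∣ s ∷ᵥ S ∣                                                   ≡⟨ head-size s ⟩
  bit (does (fzero ∈? (s ∷ᵥ S))) + ∣ S ∣                        ≡⟨ cong (head +_) (size≡count S) ⟩
  bit (does (fzero ∈? (s ∷ᵥ S))) + count (_∈? S) (allFin m)
    ≡⟨ cong (head +_) (count-ext _ _ (λ x x∈ → there x∈) (λ x → drop-there) (allFin m)) ⟩
  bit (does (fzero ∈? (s ∷ᵥ S))) + count (λ x → fsuc x ∈? (s ∷ᵥ S)) (allFin m) ≡⟨ sym (count-allFin-suc m (_∈? (s ∷ᵥ S))) ⟩
  count (_∈? (s ∷ᵥ S)) (allFin (suc m)) ∎
  where
  open ≡-Reasoning
  head : ℕ
  head = bit (does (fzero ∈? (s ∷ᵥ S)))
  head-size : ∀ s → ∣ s ∷ᵥ S ∣ ≡ bit (does (fzero ∈? (s ∷ᵥ S))) + ∣ S ∣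
  head-size true  = refl
  head-size false = refl

singleton-level : ∀ {n K} (σ : Vec (Fin K) n) v {x y} →
  count (λ z → toℕ (lookup σ z) ≟ v) (allFin n) ≡ 1 → toℕ (lookup σ x) ≡ v → toℕ (lookup σ y) ≡ v → x ≡ y
singleton-level {n} σ v {x} {y} one ex ey with x Fin.≟ y
... | yes x≡y = x≡y
... | no  x≢y = ⊥-elim (<-irrefl (sym one)
                  (count-two (λ z → toℕ (lookup σ z) ≟ v) Fin._≟_ (allFin n) ex ey x≢y (∈-allFin x) (∈-allFin y)))

-- Marked maps correspond to pairs (A, B) with A an antichain, B ⊆ A and |B| = j:
-- A is the set of maximal elements of level ≤ j and B the set of middle elements.
module MarkedMaps {n : ℕ} (P : NLPoset n) (j : ℕ) where
  open NLPoset P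
  open PPartitions P

  Map : Set
  Map = Vec (Fin (suc (suc j))) n

  middleFlags : ℕ → Bool
  middleFlags w = does (0 <? w) ∧ does (w <? j)

  SingletonMiddle : Map → Set
  SingletonMiddle σ = ∀ (w : Fin j) → fiber σ (suc (toℕ w)) ≡ 1

  Marked : Map → Set
  Marked σ = IsPPartition P σ × SingletonMiddle σ × NoAscentAt (suc j) σ middleFlags

  Marked? : ∀ σ → Dec (Marked σ)
  Marked? σ = isPPartition? P σ ×-dec all? (λ w → fiber σ (suc (toℕ w)) ≟ 1) ×-dec NoAscentAt? (suc j) σ middleFlags

  singletonMiddle⇒ : ∀ σ → SingletonMiddle σ → ∀ v → 1 ≤ v → v ≤ j → fiber σ v ≡ 1
  singletonMiddle⇒ σ singles (suc u) _ u<j = subst (λ t → fiber σ (suc t) ≡ 1) (toℕ-fromℕ< u<j) (singles (fromℕ< u<j))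

  module OfMarked (σ : Map) (marked : Marked σ) where
    private
      singles : SingletonMiddle σ
      singles = proj₁ (proj₂ marked)
      noAscent : NoAscentAt (suc j) σ middleFlags
      noAscent = proj₂ (proj₂ marked)

    middle-occupied : ∀ v → 1 ≤ v → v ≤ j → ∃ λ x → level σ x ≡ v
    middle-occupied v 1≤v v≤j =
      count-witness (λ x → level σ x ≟ v) (allFin n) (subst (0 <_) (sym (singletonMiddle⇒ σ singles v 1≤v v≤j)) (s≤s z≤n))

    consecutive-descent : ∀ x y → 1 ≤ level σ x → level σ y ≡ suc (level σ x) → level σ y ≤ j → toℕ y < toℕ x
    consecutive-descent x y 1≤x ey y≤j with <-cmp (toℕ x) (toℕ y)
    ... | tri> _ _ y<x = y<x
    ... | tri≈ _ x≡y _ = ⊥-elim (<-irrefl (cong (level σ) (toℕ-injective x≡y)) (subst (level σ x <_) (sym ey) (n<1+n _)))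
    ... | tri< x<y _ _ = ⊥-elim (noAscentAt⇒ {σ = σ} {c = middleFlags} noAscent w (m≤n⇒m≤1+n w<j) flagged ascent)
      where
      w : ℕ
      w = level σ x
      w<j : w < j
      w<j = subst (_≤ j) ey y≤j
      flagged : middleFlags w ≡ true
      flagged = cong₂ _∧_ (dec-true (0 <? w) 1≤x) (dec-true (w <? j) w<j)
      ascent : Ascent σ w
      ascent x' y' ex' ey' = subst₂ (λ a b → toℕ a < toℕ b)
        (singleton-level σ w (singletonMiddle⇒ σ singles w 1≤x (<⇒≤ w<j)) refl ex')
        (singleton-level σ (suc w) (singletonMiddle⇒ σ singles (suc w) (s≤s z≤n) w<j) ey ey') x<y

    descending : ∀ w x y → 1 ≤ level σ x → level σ x ≤ w → level σ y ≡ suc w → suc w ≤ j → toℕ y < toℕ x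
    descending w x y 1≤x x≤w ey sw≤j with m≤n⇒m<n∨m≡n x≤w
    ... | inj₂ refl = consecutive-descent x y 1≤x ey (subst (_≤ j) (sym ey) sw≤j)
    descending (suc w) x y 1≤x x≤w ey sw≤j | inj₁ (s≤s x≤w') with middle-occupied (suc w) (s≤s z≤n) (<⇒≤ sw≤j)
    ... | z , ez = <-trans (consecutive-descent z y (subst (1 ≤_) (sym ez) (s≤s z≤n)) (trans ey (cong suc (sym ez)))
                                                (subst (_≤ j) (sym ey) sw≤j))
                           (descending w x z 1≤x x≤w' ez (<⇒≤ sw≤j))

    descending-middle : ∀ x y → 1 ≤ level σ x → level σ x < level σ y → level σ y ≤ j → toℕ y < toℕ x
    descending-middle x y 1≤x x<y y≤j with level σ y in ey
    ... | suc w = descending w x y 1≤x (≤-pred x<y) ey y≤j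

    count-middle : ∀ m → m ≤ j → count (λ x → (1 ≤? level σ x) ×-dec (level σ x ≤? m)) (allFin n) ≡ m
    count-middle zero _ =
      count-zero (λ x → (1 ≤? level σ x) ×-dec (level σ x ≤? 0)) (λ x (a , b) → <-irrefl refl (≤-trans a b)) (allFin n)
    count-middle (suc m) m<j =
      trans (count-split (λ x → (1 ≤? level σ x) ×-dec (level σ x ≤? suc m)) (λ x → level σ x ≤? m) (allFin n))
        (trans (cong₂ _+_
          (trans (count-ext _ _ (λ x ((a , _) , c) → a , c) (λ x (a , c) → (a , m≤n⇒m≤1+n c) , c) (allFin n))
                 (count-middle m (<⇒≤ m<j)))
          (trans (count-ext _ _ (λ x ((a , b) , c) → ≤-antisym b (≰⇒> c))
                                (λ x e → (subst (1 ≤_) (sym e) (s≤s z≤n) , ≤-reflexive e) , λ d → <-irrefl e (s≤s d)) (allFin n))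
                 (singletonMiddle⇒ σ singles (suc m) (s≤s z≤n) m<j)))
          (+-comm m 1))

    count-above : ∀ v → v ≤ j → count (λ y → (v <? level σ y) ×-dec (level σ y ≤? j)) (allFin n) ≡ j ∸ v
    count-above v v≤j = trans (sym (m+n∸m≡n v above)) (cong (_∸ v) (begin
      v + above               ≡⟨ cong (_+ above) (sym (count-middle v v≤j)) ⟩
      upTo v + above          ≡⟨ sym split ⟩
      upTo j                  ≡⟨ count-middle j ≤-refl ⟩
      j                       ∎))
      where
      open ≡-Reasoning
      upTo : ℕ → ℕ
      upTo m = count (λ x → (1 ≤? level σ x) ×-dec (level σ x ≤? m)) (allFin n)
      above : ℕ
      above = count (λ y → (v <? level σ y) ×-dec (level σ y ≤? j)) (allFin n)
      split : upTo j ≡ upTo v + above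
      split = trans (count-split (λ x → (1 ≤? level σ x) ×-dec (level σ x ≤? j)) (λ x → level σ x ≤? v) (allFin n))
        (cong₂ _+_ (count-ext _ _ (λ x ((a , _) , c) → a , c) (λ x (a , c) → (a , ≤-trans c v≤j) , c) (allFin n))
                   (count-ext _ _ (λ x ((a , b) , c) → ≰⇒> c , b) (λ x (a , b) → (≤-trans (s≤s z≤n) a , b) , <⇒≱ a) (allFin n)))

  private
    ≼-refl : ∀ {x} → x ≼ x
    ≼-refl = IsPartialOrder.refl isPartialOrder
    ≼-trans : ∀ {x y z} → x ≼ y → y ≼ z → x ≼ z
    ≼-trans = IsPartialOrder.trans isPartialOrder
    ≼-antisym : ∀ {x y} → x ≼ y → y ≼ x → x ≡ y
    ≼-antisym = IsPartialOrder.antisym isPartialOrder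

  MarkedPair : Subset n × Subset n → Set
  MarkedPair (A , B) = IsAntichain P A × B ⊆ A × ∣ B ∣ ≡ j

  MarkedPair? : ∀ p → Dec (MarkedPair p)
  MarkedPair? (A , B) = isAntichain? P A ×-dec B ⊆? A ×-dec (∣ B ∣ ≟ j)

  antichain-≼ : ∀ {A} → IsAntichain P A → ∀ {x y} → x ∈ₛ A → y ∈ₛ A → x ≼ y → x ≡ y
  antichain-≼ anti {x} {y} x∈ y∈ x≼y with x Fin.≟ y
  ... | yes x≡y = x≡y
  ... | no  x≢y = ⊥-elim (anti x y x∈ y∈ x≢y x≼y)

  Middle? : (σ : Map) → ∀ x → Dec (1 ≤ level σ x × level σ x ≤ j)
  Middle? σ x = (1 ≤? level σ x) ×-dec (level σ x ≤? j)

  Maximal : Map → Fin n → Set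
  Maximal σ x = level σ x ≤ j × (∀ y → x ≼ y → level σ y ≤ j → x ≡ y)

  Maximal? : ∀ σ x → Dec (Maximal σ x)
  Maximal? σ x = (level σ x ≤? j) ×-dec all? (λ y → (x ≼? y) →-dec ((level σ y ≤? j) →-dec (x Fin.≟ y)))

  toPair : Map → Subset n × Subset n
  toPair σ = Vec.tabulate (λ x → does (Maximal? σ x)) , Vec.tabulate (λ x → does (Middle? σ x))

  -- From a pair: B is laid out on the levels j, j-1, …, 1 in increasing label
  -- order, the rest of the down-set of A goes to level 0 and everything else to j+1.
  Below : Subset n → Fin n → Set
  Below A x = ∃ λ a → a ∈ₛ A × x ≼ a

  Below? : ∀ A x → Dec (Below A x)
  Below? A x = any? λ a → (a ∈? A) ×-dec (x ≼? a)

  pairLevel : ∀ (A B : Subset n) x → Dec (x ∈ₛ B) → Dec (Below A x) → ℕ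
  pairLevel A B x (yes _) _       = j ∸ rank (_∈? B) x
  pairLevel A B x (no _)  (yes _) = 0
  pairLevel A B x (no _)  (no _)  = suc j

  pairLevel<j+2 : ∀ A B x d₁ d₂ → pairLevel A B x d₁ d₂ < suc (suc j)
  pairLevel<j+2 A B x (yes _) _       = s≤s (≤-trans (m∸n≤m j (rank (_∈? B) x)) (n≤1+n j))
  pairLevel<j+2 A B x (no _)  (yes _) = s≤s z≤n
  pairLevel<j+2 A B x (no _)  (no _)  = ≤-refl

  fromPair : Subset n × Subset n → Map
  fromPair (A , B) = Vec.tabulate (λ x → fromℕ< (pairLevel<j+2 A B x (x ∈? B) (Below? A x)))

  fromPair-level : ∀ A B x → level (fromPair (A , B)) x ≡ pairLevel A B x (x ∈? B) (Below? A x)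
  fromPair-level A B x = trans (cong toℕ (lookup∘tabulate _ x)) (toℕ-fromℕ< _)

  level-in-B : ∀ A B {x} → x ∈ₛ B → level (fromPair (A , B)) x ≡ j ∸ rank (_∈? B) x
  level-in-B A B {x} x∈B = trans (fromPair-level A B x) (by (x ∈? B) (Below? A x))
    where
    by : ∀ d₁ d₂ → pairLevel A B x d₁ d₂ ≡ j ∸ rank (_∈? B) x
    by (yes _)  _ = refl
    by (no x∉B) _ = ⊥-elim (x∉B x∈B)

  level-below : ∀ A B {x} → ¬ x ∈ₛ B → Below A x → level (fromPair (A , B)) x ≡ 0
  level-below A B {x} x∉B below = trans (fromPair-level A B x) (by (x ∈? B) (Below? A x))
    where
    by : ∀ d₁ d₂ → pairLevel A B x d₁ d₂ ≡ 0
    by (yes x∈B) _         = ⊥-elim (x∉B x∈B)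
    by (no _)    (yes _)   = refl
    by (no _)    (no ¬bel) = ⊥-elim (¬bel below)

  level-above : ∀ A B {x} → ¬ x ∈ₛ B → ¬ Below A x → level (fromPair (A , B)) x ≡ suc j
  level-above A B {x} x∉B ¬below = trans (fromPair-level A B x) (by (x ∈? B) (Below? A x))
    where
    by : ∀ d₁ d₂ → pairLevel A B x d₁ d₂ ≡ suc j
    by (yes x∈B) _         = ⊥-elim (x∉B x∈B)
    by (no _)    (yes bel) = ⊥-elim (¬below bel)
    by (no _)    (no _)    = refl

  module FromPair (A B : Subset n) (pair : MarkedPair (A , B)) where
    private
      anti : IsAntichain P A
      anti = proj₁ pair
      B⊆A : B ⊆ A
      B⊆A = proj₁ (proj₂ pair)
      σ : Map
      σ = fromPair (A , B)
      rankB : Fin n → ℕ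
      rankB = rank (_∈? B)

    size-B : count (_∈? B) (allFin n) ≡ j
    size-B = trans (sym (size≡count B)) (proj₂ (proj₂ pair))

    rank<j : ∀ {x} → x ∈ₛ B → rankB x < j
    rank<j {x} x∈B = subst (rankB x <_) size-B (rank<size (_∈? B) x x∈B)

    below-self : ∀ {a} → a ∈ₛ A → Below A a
    below-self {a} a∈A = a , a∈A , ≼-refl

    outside-B : ∀ {x} → ¬ x ∈ₛ B → level σ x ≡ 0 ⊎ level σ x ≡ suc j
    outside-B {x} x∉B with Below? A x
    ... | yes below = inj₁ (level-below A B x∉B below)
    ... | no ¬below = inj₂ (level-above A B x∉B ¬below)

    middle⇒B : ∀ {x} v → level σ x ≡ v → 1 ≤ v → v ≤ j → x ∈ₛ B × rankB x ≡ j ∸ v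
    middle⇒B {x} v ex 1≤v v≤j with x ∈? B
    ... | yes x∈B = x∈B , trans (sym (m∸[m∸n]≡n (<⇒≤ (rank<j x∈B)))) (cong (j ∸_) (trans (sym (level-in-B A B x∈B)) ex))
    ... | no  x∉B with outside-B x∉B
    ... | inj₁ e0 = ⊥-elim (<-irrefl refl (≤-trans 1≤v (≤-reflexive (trans (sym ex) e0))))
    ... | inj₂ e1 = ⊥-elim (<-irrefl refl (≤-trans (≤-reflexive (sym (trans (sym ex) e1))) v≤j))

    B⇒middle : ∀ {x} v → x ∈ₛ B → rankB x ≡ j ∸ v → v ≤ j → level σ x ≡ v
    B⇒middle v x∈B r≡ v≤j = trans (level-in-B A B x∈B) (trans (cong (j ∸_) r≡) (m∸[m∸n]≡n v≤j))

    low⇒below : ∀ y → level σ y ≤ j → Below A y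
    low⇒below y y≤j with y ∈? B
    ... | yes y∈B = below-self (B⊆A y∈B)
    ... | no  y∉B with Below? A y
    ... | yes below = below
    ... | no ¬below = ⊥-elim (<-irrefl refl (≤-trans (≤-reflexive (sym (level-above A B y∉B ¬below))) y≤j))

    below⇒low : ∀ y → Below A y → level σ y ≤ j
    below⇒low y below with y ∈? B
    ... | yes y∈B = ≤-trans (≤-reflexive (level-in-B A B y∈B)) (m∸n≤m j (rankB y))
    ... | no  y∉B = ≤-trans (≤-reflexive (level-below A B y∉B below)) z≤n

    isPPartition-σ : IsPPartition P σ
    isPPartition-σ x y x≼y with y ∈? B | x ∈? B
    ... | yes y∈B | yes x∈B = ≤-reflexive (cong (level σ) (antichain-≼ anti (B⊆A x∈B) (B⊆A y∈B) x≼y))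
    ... | yes y∈B | no  x∉B = ≤-trans (≤-reflexive (level-below A B x∉B (y , B⊆A y∈B , x≼y))) z≤n
    ... | no  y∉B | _ with Below? A y
    isPPartition-σ x y x≼y | no y∉B | _ | no ¬below =
      subst (level σ x ≤_) (sym (level-above A B y∉B ¬below)) (≤-pred (toℕ<n (lookup σ x)))
    isPPartition-σ x y x≼y | no y∉B | yes x∈B | yes (a , a∈A , y≼a) =
      ⊥-elim (y∉B (subst (_∈ₛ B) (≼-antisym x≼y (subst (y ≼_) (sym x≡a) y≼a)) x∈B))
      where
      x≡a : x ≡ a
      x≡a = antichain-≼ anti (B⊆A x∈B) a∈A (≼-trans x≼y y≼a)
    isPPartition-σ x y x≼y | no y∉B | no x∉B | yes (a , a∈A , y≼a) =
      ≤-trans (≤-reflexive (level-below A B x∉B (a , a∈A , ≼-trans x≼y y≼a))) z≤n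

    singletons-σ : SingletonMiddle σ
    singletons-σ w = trans
      (count-ext _ (λ x → (x ∈? B) ×-dec (rankB x ≟ j ∸ suc u))
         (λ x ex → middle⇒B (suc u) ex (s≤s z≤n) u<j) (λ x (x∈B , r≡) → B⇒middle (suc u) x∈B r≡ u<j) (allFin n))
      (count-rank≡ (_∈? B) (j ∸ suc u) (subst (j ∸ suc u <_) (sym size-B) (∸-monoʳ-< (s≤s z≤n) u<j)))
      where
      u : ℕ
      u = toℕ w
      u<j : u < j
      u<j = toℕ<n w

    noAscent-σ : NoAscentAt (suc j) σ middleFlags
    noAscent-σ = ⇒noAscentAt {σ = σ} {c = middleFlags} no-ascent
      where
      no-ascent : ∀ v → v < suc j → middleFlags v ≡ true → ¬ Ascent σ v
      no-ascent zero    _ flag _ = false≢true flag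
      no-ascent (suc u) _ flag ascent = <-irrefl refl (<-≤-trans ranks (rank-mono (_∈? B) x y (<⇒≤ x<y)))
        where
        v<j : suc u < j
        v<j = does-true⇒ (suc u <? j) flag
        occupied : ∀ v → 1 ≤ v → v ≤ j → ∃ λ x → level σ x ≡ v
        occupied v 1≤v v≤j = count-witness (λ x → level σ x ≟ v) (allFin n)
          (subst (0 <_) (sym (singletonMiddle⇒ σ singletons-σ v 1≤v v≤j)) (s≤s z≤n))
        x y : Fin n
        x = proj₁ (occupied (suc u) (s≤s z≤n) (<⇒≤ v<j))
        y = proj₁ (occupied (suc (suc u)) (s≤s z≤n) v<j)
        ex : level σ x ≡ suc u
        ex = proj₂ (occupied (suc u) (s≤s z≤n) (<⇒≤ v<j))
        ey : level σ y ≡ suc (suc u)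
        ey = proj₂ (occupied (suc (suc u)) (s≤s z≤n) v<j)
        x<y : toℕ x < toℕ y
        x<y = ascent x y ex ey
        ranks : rankB y < rankB x
        ranks = subst₂ _<_ (sym (proj₂ (middle⇒B (suc (suc u)) ey (s≤s z≤n) v<j)))
                           (sym (proj₂ (middle⇒B (suc u) ex (s≤s z≤n) (<⇒≤ v<j))))
                           (∸-monoʳ-< (n<1+n (suc u)) v<j)

    marked : Marked σ
    marked = isPPartition-σ , singletons-σ , noAscent-σ

    toPair∘fromPair : toPair σ ≡ (A , B)
    toPair∘fromPair = cong₂ _,_ (subset-ext (Maximal? σ) maximal⇔) (subset-ext (Middle? σ) middle⇔)
      where
      maximal⇔ : ∀ x → Maximal σ x ⇔ x ∈ₛ A
      maximal⇔ x = mk⇔ to from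
        where
        to : Maximal σ x → x ∈ₛ A
        to (x≤j , maximal) with low⇒below x x≤j
        ... | a , a∈A , x≼a = subst (_∈ₛ A) (sym (maximal a x≼a (below⇒low a (below-self a∈A)))) a∈A
        from : x ∈ₛ A → Maximal σ x
        from x∈A = below⇒low x (below-self x∈A) , λ y x≼y y≤j →
          let (a , a∈A , y≼a) = low⇒below y y≤j
          in ≼-antisym x≼y (subst (y ≼_) (sym (antichain-≼ anti x∈A a∈A (≼-trans x≼y y≼a))) y≼a)
      middle⇔ : ∀ x → (1 ≤ level σ x × level σ x ≤ j) ⇔ x ∈ₛ B
      middle⇔ x = mk⇔ (λ (1≤ , ≤j) → proj₁ (middle⇒B (level σ x) refl 1≤ ≤j))
                      (λ x∈B → subst (λ t → 1 ≤ t × t ≤ j) (sym (level-in-B A B x∈B))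
                                     (m<n⇒0<n∸m (rank<j x∈B) , m∸n≤m j (rankB x)))

  module ToPair (σ : Map) (marked : Marked σ) where
    open OfMarked σ marked
    private
      pp : IsPPartition P σ
      pp = proj₁ marked
      singles : SingletonMiddle σ
      singles = proj₁ (proj₂ marked)
      A B : Subset n
      A = proj₁ (toPair σ)
      B = proj₂ (toPair σ)
      maximal⇔ : ∀ x → x ∈ₛ A ⇔ Maximal σ x
      maximal⇔ = ∈-decided⇔ (Maximal? σ)
      middle⇔ : ∀ x → x ∈ₛ B ⇔ (1 ≤ level σ x × level σ x ≤ j)
      middle⇔ = ∈-decided⇔ (Middle? σ)

    -- Every middle element is maximal: an element above it of level ≤ j would
    -- have a larger level, hence (by 'descending-middle') a smaller label.
    middle⊆maximal : B ⊆ A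
    middle⊆maximal {x} x∈B = Equivalence.from (maximal⇔ x) (x≤j , maximal)
      where
      1≤x : 1 ≤ level σ x
      1≤x = proj₁ (Equivalence.to (middle⇔ x) x∈B)
      x≤j : level σ x ≤ j
      x≤j = proj₂ (Equivalence.to (middle⇔ x) x∈B)
      maximal : ∀ y → x ≼ y → level σ y ≤ j → x ≡ y
      maximal y x≼y y≤j with x Fin.≟ y
      ... | yes x≡y = x≡y
      ... | no  x≢y with <-cmp (level σ x) (level σ y)
      ... | tri< x<y _ _ = ⊥-elim (<-irrefl refl (<-≤-trans (descending-middle x y 1≤x x<y y≤j) (natural x≼y)))
      ... | tri≈ _ x≡y _ =
        ⊥-elim (x≢y (singleton-level σ (level σ x) (singletonMiddle⇒ σ singles (level σ x) 1≤x x≤j) refl (sym x≡y)))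
      ... | tri> _ _ y<x = ⊥-elim (<-irrefl refl (<-≤-trans y<x (pp x y x≼y)))

    markedPair : MarkedPair (toPair σ)
    markedPair = antichain , middle⊆maximal , size
      where
      antichain : IsAntichain P A
      antichain x y x∈A y∈A x≢y x≼y =
        x≢y (proj₂ (Equivalence.to (maximal⇔ x) x∈A) y x≼y (proj₁ (Equivalence.to (maximal⇔ y) y∈A)))
      size : ∣ B ∣ ≡ j
      size = trans (size≡count B) (trans (count-ext _ (Middle? σ) (λ x → Equivalence.to (middle⇔ x))
                                                                  (λ x → Equivalence.from (middle⇔ x)) (allFin n))
                                         (count-middle j ≤-refl))

    -- Every element of level ≤ j lies below a maximal one (search upwards in label order).
    below-maximal : ∀ x → level σ x ≤ j → Below A x
    below-maximal x = search n x (m≤n+m n (toℕ x))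
      where
      search : ∀ d x → n ≤ toℕ x + d → level σ x ≤ j → Below A x
      search zero x n≤x _ = ⊥-elim (<-irrefl refl (<-≤-trans (toℕ<n x) (≤-trans n≤x (≤-reflexive (+-identityʳ _)))))
      search (suc d) x n≤ x≤j with Maximal? σ x
      ... | yes max = x , Equivalence.from (maximal⇔ x) max , ≼-refl
      ... | no ¬max with any? (λ y → (x ≼? y) ×-dec ((level σ y ≤? j) ×-dec ¬? (x Fin.≟ y)))
      ... | no none = ⊥-elim (¬max (x≤j , λ y x≼y y≤j → decidable-stable (x Fin.≟ y) (λ x≢y → none (y , x≼y , y≤j , x≢y))))
      ... | yes (y , x≼y , y≤j , x≢y)
              with search d y (≤-trans n≤ (≤-trans (≤-reflexive (+-suc (toℕ x) d)) (+-monoˡ-≤ d x<y))) y≤j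
        where
        x<y : toℕ x < toℕ y
        x<y = ≤∧≢⇒< (natural x≼y) (λ e → x≢y (toℕ-injective e))
      ... | a , a∈A , y≼a = a , a∈A , ≼-trans x≼y y≼a

    fromPair∘toPair : fromPair (toPair σ) ≡ σ
    fromPair∘toPair = vec-ext _ _ λ x → toℕ-injective (restore x)
      where
      restore : ∀ x → level (fromPair (toPair σ)) x ≡ level σ x
      restore x with Middle? σ x
      ... | yes (1≤x , x≤j) = trans (level-in-B A B x∈B) (trans (cong (j ∸_) same-rank) (m∸[m∸n]≡n x≤j))
        where
        x∈B : x ∈ₛ B
        x∈B = Equivalence.from (middle⇔ x) (1≤x , x≤j)
        higher⇔ : ∀ y → (y ∈ₛ B × toℕ y < toℕ x) ⇔ (level σ x < level σ y × level σ y ≤ j)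
        higher⇔ y = mk⇔ to (λ (x<y , y≤j) → Equivalence.from (middle⇔ y) (≤-trans 1≤x (<⇒≤ x<y) , y≤j) ,
                                             descending-middle x y 1≤x x<y y≤j)
          where
          to : y ∈ₛ B × toℕ y < toℕ x → level σ x < level σ y × level σ y ≤ j
          to (y∈B , y<x) with Equivalence.to (middle⇔ y) y∈B
          ... | 1≤y , y≤j with <-cmp (level σ y) (level σ x)
          ... | tri< ly<lx _ _ = ⊥-elim (<-asym y<x (descending-middle y x 1≤y ly<lx x≤j))
          ... | tri≈ _ ly≡lx _ = ⊥-elim (<-irrefl (cong toℕ (singleton-level σ (level σ x)
                                   (singletonMiddle⇒ σ singles (level σ x) 1≤x x≤j) ly≡lx refl)) y<x)
          ... | tri> _ _ lx<ly = lx<ly , y≤j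
        same-rank : rank (_∈? B) x ≡ j ∸ level σ x
        same-rank = trans (count-ext _ _ (λ y → Equivalence.to (higher⇔ y)) (λ y → Equivalence.from (higher⇔ y)) (allFin n))
                          (count-above (level σ x) x≤j)
      ... | no ¬middle with level σ x ≤? j
      ... | yes x≤j = trans (level-below A B x∉B (below-maximal x x≤j)) (sym x-bottom)
        where
        x∉B : ¬ x ∈ₛ B
        x∉B x∈B = ¬middle (Equivalence.to (middle⇔ x) x∈B)
        x-bottom : level σ x ≡ 0
        x-bottom with level σ x
        ... | zero  = refl
        ... | suc _ = ⊥-elim (¬middle (s≤s z≤n , x≤j))
      ... | no x≰j = trans (level-above A B x∉B ¬below) (≤-antisym (≰⇒> x≰j) (≤-pred (toℕ<n (lookup σ x))))
        where
        x∉B : ¬ x ∈ₛ B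
        x∉B x∈B = x≰j (proj₂ (Equivalence.to (middle⇔ x) x∈B))
        ¬below : ¬ Below A x
        ¬below (a , a∈A , x≼a) = x≰j (≤-trans (pp x a x≼a) (proj₁ (Equivalence.to (maximal⇔ a) a∈A)))

sumTo : ℕ → (ℕ → ℕ) → ℕ
sumTo zero    f = f 0
sumTo (suc N) f = sumTo N f + f (suc N)

sumTo-ext : ∀ N f g → (∀ m → m ≤ N → f m ≡ g m) → sumTo N f ≡ sumTo N g
sumTo-ext zero    f g f≡g = f≡g 0 z≤n
sumTo-ext (suc N) f g f≡g = cong₂ _+_ (sumTo-ext N f g (λ m m≤N → f≡g m (m≤n⇒m≤1+n m≤N))) (f≡g (suc N) ≤-refl)

sumTo-+ : ∀ N f g → sumTo N (λ m → f m + g m) ≡ sumTo N f + sumTo N g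
sumTo-+ zero    f g = refl
sumTo-+ (suc N) f g = trans (cong (_+ (f (suc N) + g (suc N))) (sumTo-+ N f g))
                            (+-assoc-swap (sumTo N f) (sumTo N g) (f (suc N)) (g (suc N)))
  where
  +-assoc-swap : ∀ a b c d → (a + b) + (c + d) ≡ (a + c) + (b + d)
  +-assoc-swap a b c d = trans (+-assoc a b (c + d)) (trans (cong (a +_) (+-comm b (c + d)))
    (trans (cong (a +_) (+-assoc c d b)) (trans (cong (λ t → a + (c + t)) (+-comm d b)) (sym (+-assoc a c (b + d))))))

sumTo-zero : ∀ N f → (∀ m → m ≤ N → f m ≡ 0) → sumTo N f ≡ 0
sumTo-zero zero    f f≡0 = f≡0 0 z≤n
sumTo-zero (suc N) f f≡0 = cong₂ _+_ (sumTo-zero N f (λ m m≤N → f≡0 m (m≤n⇒m≤1+n m≤N))) (f≡0 (suc N) ≤-refl)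

sumTo-single : ∀ N f t → t ≤ N → (∀ m → m ≢ t → f m ≡ 0) → sumTo N f ≡ f t
sumTo-single zero    f zero _ _ = refl
sumTo-single (suc N) f t t≤N others with t ≟ suc N
... | yes refl = cong (_+ f (suc N)) (sumTo-zero N f (λ m m≤N → others m (λ e → <-irrefl e (s≤s m≤N))))
... | no  t≢N  = trans (cong₂ _+_ (sumTo-single N f t (≤-pred (≤∧≢⇒< t≤N t≢N)) others) (others (suc N) (λ e → t≢N (sym e))))
                       (+-identityʳ (f t))

sumTo-except : ∀ N f g m → m ≤ N → (∀ m' → m' ≤ N → m' ≢ m → f m' ≡ g m') → sumTo N f + g m ≡ sumTo N g + f m
sumTo-except zero f g zero _ _ = +-comm (f 0) (g 0)
sumTo-except (suc N) f g m m≤N agree with m ≟ suc N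
... | yes refl = trans (+-assoc (sumTo N f) _ _)
                   (trans (cong₂ _+_ rest (+-comm (f (suc N)) (g (suc N)))) (sym (+-assoc (sumTo N g) _ _)))
  where
  rest : sumTo N f ≡ sumTo N g
  rest = sumTo-ext N f g (λ m' m'≤N → agree m' (m≤n⇒m≤1+n m'≤N) (λ e → <-irrefl e (s≤s m'≤N)))
... | no m≢N = trans (swap (sumTo N f) (f (suc N)) (g m))
                 (trans (cong₂ _+_ (sumTo-except N f g m (≤-pred (≤∧≢⇒< m≤N m≢N))
                                                 (λ m' m'≤N → agree m' (m≤n⇒m≤1+n m'≤N)))
                                   (agree (suc N) ≤-refl (λ e → m≢N (sym e))))
                        (sym (swap (sumTo N g) (g (suc N)) (f m))))
  where
  swap : ∀ a b c → (a + b) + c ≡ (a + c) + b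
  swap a b c = trans (+-assoc a b c) (trans (cong (a +_) (+-comm b c)) (sym (+-assoc a c b)))

count-by-value : ∀ {A : Set} {P : A → Set} (P? : ∀ a → Dec (P a)) (h : A → ℕ) N xs → (∀ x → h x ≤ N) →
  count P? xs ≡ sumTo N (λ v → count (λ x → P? x ×-dec (h x ≟ v)) xs)
count-by-value P? h N xs bounded = trans (count-ext _ _ (λ x p → p , bounded x) (λ x (p , _) → p) xs) (up-to N)
  where
  up-to : ∀ N → count (λ x → P? x ×-dec (h x ≤? N)) xs ≡ sumTo N (λ v → count (λ x → P? x ×-dec (h x ≟ v)) xs)
  up-to zero = count-ext _ _ (λ x (p , h≤0) → p , n≤0⇒n≡0 h≤0) (λ x (p , h≡0) → p , ≤-reflexive h≡0) xs
  up-to (suc N) = trans (count-split (λ x → P? x ×-dec (h x ≤? suc N)) (λ x → h x ≤? N) xs)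
    (cong₂ _+_ (trans (count-ext _ _ (λ x ((p , _) , q) → p , q) (λ x (p , q) → (p , m≤n⇒m≤1+n q) , q) xs) (up-to N))
               (count-ext _ _ (λ x ((p , q) , r) → p , ≤-antisym q (≰⇒> r))
                              (λ x (p , e) → (p , ≤-reflexive e) , λ r → <-irrefl e (s≤s r)) xs))

count-cartesianProduct : ∀ {A B : Set} {Q : A × B → Set} (Q? : ∀ p → Dec (Q p)) (xs : List A) (ys : List B) →
  count Q? (cartesianProduct xs ys) ≡ sum (map (λ a → count (λ b → Q? (a , b)) ys) xs)
count-cartesianProduct Q? [] ys = refl
count-cartesianProduct Q? (x ∷ xs) ys = trans (count-++ Q? (map (x ,_) ys) _)
  (cong₂ _+_ (count-map Q? (x ,_) ys) (count-cartesianProduct Q? xs ys))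

Sub? : ∀ {m} (A : Subset m) t B → Dec (B ⊆ A × ∣ B ∣ ≡ t)
Sub? A t B = (B ⊆? A) ×-dec (∣ B ∣ ≟ t)

count-without-first : ∀ {m} a (A : Subset m) t →
  count (λ B → Sub? (a ∷ᵥ A) t (false ∷ᵥ B)) (allSubsets m) ≡ count (Sub? A t) (allSubsets m)
count-without-first {m} a A t = count-ext (λ B → Sub? (a ∷ᵥ A) t (false ∷ᵥ B)) (Sub? A t)
  (λ B (B⊆ , e) → drop-∷-⊆ B⊆ , e) (λ B (B⊆ , e) → out⊆ B⊆ , e) (allSubsets m)

-- A subset of size m has m C t subsets of size t: split the subsets of Fin (suc m)
-- according to whether they contain the first element (Pascal's rule).
count-subsets : ∀ m (A : Subset m) t → count (Sub? A t) (allSubsets m) ≡ ∣ A ∣ C t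
count-subsets zero []ᵥ zero    = refl
count-subsets zero []ᵥ (suc t) = refl
count-subsets (suc m) (false ∷ᵥ A) t = begin
  count (Sub? (false ∷ᵥ A) t) (allSubsets (suc m))                  ≡⟨ count-allSubsets-suc m (Sub? (false ∷ᵥ A) t) ⟩
  count (λ B → Sub? (false ∷ᵥ A) t (true ∷ᵥ B)) (allSubsets m) + rest
    ≡⟨ cong (_+ rest) (count-zero _ (λ B (B⊆ , _) → ∉-false (B⊆ here)) (allSubsets m)) ⟩
  count (λ B → Sub? (false ∷ᵥ A) t (false ∷ᵥ B)) (allSubsets m)     ≡⟨ trans (count-without-first false A t) (count-subsets m A t) ⟩
  ∣ A ∣ C t                                                          ∎
  where
  open ≡-Reasoning
  rest = count (λ B → Sub? (false ∷ᵥ A) t (false ∷ᵥ B)) (allSubsets m)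
  ∉-false : ¬ fzero ∈ₛ (false ∷ᵥ A)
  ∉-false ()
count-subsets (suc m) (true ∷ᵥ A) zero = begin
  count (Sub? (true ∷ᵥ A) 0) (allSubsets (suc m))                  ≡⟨ count-allSubsets-suc m (Sub? (true ∷ᵥ A) 0) ⟩
  count (λ B → Sub? (true ∷ᵥ A) 0 (true ∷ᵥ B)) (allSubsets m) + rest
    ≡⟨ cong (_+ rest) (count-zero _ (λ { B (_ , ()) }) (allSubsets m)) ⟩
  count (λ B → Sub? (true ∷ᵥ A) 0 (false ∷ᵥ B)) (allSubsets m)     ≡⟨ trans (count-without-first true A 0) (count-subsets m A 0) ⟩
  ∣ A ∣ C 0                                                         ∎
  where
  open ≡-Reasoning
  rest = count (λ B → Sub? (true ∷ᵥ A) 0 (false ∷ᵥ B)) (allSubsets m)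
count-subsets (suc m) (true ∷ᵥ A) (suc t) = begin
  count (Sub? (true ∷ᵥ A) (suc t)) (allSubsets (suc m))
    ≡⟨ count-allSubsets-suc m (Sub? (true ∷ᵥ A) (suc t)) ⟩
  count (λ B → Sub? (true ∷ᵥ A) (suc t) (true ∷ᵥ B)) (allSubsets m)
    + count (λ B → Sub? (true ∷ᵥ A) (suc t) (false ∷ᵥ B)) (allSubsets m)
    ≡⟨ cong₂ _+_ with-first (trans (count-without-first true A (suc t)) (count-subsets m A (suc t))) ⟩
  ∣ A ∣ C t + ∣ A ∣ C suc t
    ≡⟨ nCk+nC[k+1]≡[n+1]C[k+1] ∣ A ∣ t ⟩
  suc ∣ A ∣ C suc t ∎
  where
  open ≡-Reasoning
  with-first : count (λ B → Sub? (true ∷ᵥ A) (suc t) (true ∷ᵥ B)) (allSubsets m) ≡ ∣ A ∣ C t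
  with-first = trans (count-ext (λ B → Sub? (true ∷ᵥ A) (suc t) (true ∷ᵥ B)) (Sub? A t)
                                (λ B (B⊆ , e) → drop-∷-⊆ B⊆ , suc-injective e) (λ B (B⊆ , e) → in⊆in B⊆ , cong suc e) (allSubsets m))
                     (count-subsets m A t)


sum-by-value : ∀ {A : Set} {D : A → Set} (D? : ∀ a → Dec (D a)) (h : A → ℕ) (g : ℕ → ℕ) N xs → (∀ x → h x ≤ N) →
  sum (map (λ x → bit (does (D? x)) * g (h x)) xs) ≡ sumTo N (λ t → g t * count (λ x → D? x ×-dec (h x ≟ t)) xs)
sum-by-value D? h g N [] _ = sym (sumTo-zero N (λ t → g t * 0) (λ t _ → *-zeroʳ (g t)))
sum-by-value {D = D} D? h g N (x ∷ xs) bounded = begin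
  bit (does (D? x)) * g (h x) + sum (map (λ y → bit (does (D? y)) * g (h y)) xs)
    ≡⟨ cong₂ _+_ (sym (head-term (D? x))) (sum-by-value D? h g N xs bounded) ⟩
  sumTo N (λ t → g t * bit (does (D?ₜ t x))) + sumTo N (λ t → g t * count (D?ₜ t) xs)
    ≡⟨ sym (sumTo-+ N _ _) ⟩
  sumTo N (λ t → g t * bit (does (D?ₜ t x)) + g t * count (D?ₜ t) xs)
    ≡⟨ sumTo-ext N _ _ (λ t _ → trans (sym (*-distribˡ-+ (g t) _ _)) (cong (g t *_) (sym (count-∷ (D?ₜ t) x xs)))) ⟩
  sumTo N (λ t → g t * count (D?ₜ t) (x ∷ xs)) ∎
  where
  open ≡-Reasoning
  D?ₜ : ∀ t y → Dec (D y × h y ≡ t)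
  D?ₜ t y = D? y ×-dec (h y ≟ t)
  -- The head contributes only to the term t = h x.
  head-term : (d : Dec (D x)) → sumTo N (λ t → g t * bit (does (d ×-dec (h x ≟ t)))) ≡ bit (does d) * g (h x)
  head-term (yes dx) = trans
    (sumTo-single N _ (h x) (bounded x)
      (λ t t≢ → trans (cong (g t *_) (bit-no (yes dx ×-dec (h x ≟ t)) (λ (_ , e) → t≢ (sym e)))) (*-zeroʳ (g t))))
    (trans (cong (g (h x) *_) (bit-yes (yes dx ×-dec (h x ≟ h x)) (dx , refl))) (trans (*-identityʳ _) (sym (+-identityʳ _))))
  head-term (no ¬dx) =
    sumTo-zero N _ (λ t _ → trans (cong (g t *_) (bit-no (no ¬dx ×-dec (h x ≟ t)) (λ (d , _) → ¬dx d))) (*-zeroʳ (g t)))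

-- By downward induction on m, since the
-- transform at j involves p j with coefficient 1 and otherwise only p m for m > j.
binomial-inversion : ∀ N (p q : ℕ → ℕ) → (∀ m → N < m → p m ≡ 0) → (∀ m → N < m → q m ≡ 0) →
  (∀ j → sumTo N (λ m → (m C j) * p m) ≡ sumTo N (λ m → (m C j) * q m)) → ∀ m → p m ≡ q m
binomial-inversion N p q p-support q-support transforms m = from-top N m (m≤n+m N m)
  where
  step : ∀ m → (∀ m' → m < m' → p m' ≡ q m') → p m ≡ q m
  step m above with m ≤? N
  ... | no m≰N = trans (p-support m (≰⇒> m≰N)) (sym (q-support m (≰⇒> m≰N)))
  ... | yes m≤N = begin
      p m      ≡⟨ sym (diagonal (p m)) ⟩
      F m      ≡⟨ diagonal-terms ⟩
      G m      ≡⟨ diagonal (q m) ⟩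
      q m      ∎
    where
    open ≡-Reasoning
    F G : ℕ → ℕ
    F m' = (m' C m) * p m'
    G m' = (m' C m) * q m'
    diagonal : ∀ x → (m C m) * x ≡ x
    diagonal x = trans (cong (_* x) (nCn≡1 m)) (+-identityʳ x)
    off-diagonal : ∀ m' → m' ≤ N → m' ≢ m → F m' ≡ G m'
    off-diagonal m' _ m'≢m with <-cmp m' m
    ... | tri< m'<m _ _ = trans (cong (_* p m') (k>n⇒nCk≡0 m'<m)) (sym (cong (_* q m') (k>n⇒nCk≡0 m'<m)))
    ... | tri≈ _ m'≡m _ = ⊥-elim (m'≢m m'≡m)
    ... | tri> _ _ m<m' = cong ((m' C m) *_) (above m' m<m')
    -- The transforms at m agree and differ termwise only at m' = m.
    diagonal-terms : F m ≡ G m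
    diagonal-terms = +-cancelˡ-≡ (sumTo N G) _ _ (begin
      sumTo N G + F m   ≡⟨ sym (sumTo-except N F G m m≤N off-diagonal) ⟩
      sumTo N F + G m   ≡⟨ cong (_+ G m) (transforms m) ⟩
      sumTo N G + G m   ∎)
  -- Downward induction on m, with d bounding N ∸ m.
  from-top : ∀ d m → N ≤ m + d → p m ≡ q m
  from-top zero m N≤m = step m (λ m' m<m' → let N<m' = ≤-<-trans (≤-trans N≤m (≤-reflexive (+-identityʳ m))) m<m'
                                           in trans (p-support m' N<m') (sym (q-support m' N<m')))
  from-top (suc d) m N≤ = step m (λ m' m<m' → from-top d m' (≤-trans N≤ (≤-trans (≤-reflexive (+-suc m d)) (+-monoˡ-≤ d m<m'))))

-- The content of a marked map with a elements on level 0 and b on level j+1.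
markedContent : ℕ → ℕ → ℕ → ℕ → ℕ
markedContent j a b zero    = a
markedContent j a b (suc v) = if does (v <? j) then 1 else b

markedContent-middle : ∀ j a b v → v < j → markedContent j a b (suc v) ≡ 1
markedContent-middle j a b v v<j rewrite dec-true (v <? j) v<j = refl

markedContent-top : ∀ j a b → markedContent j a b (suc j) ≡ b
markedContent-top j a b rewrite dec-false (j <? j) (<-irrefl refl) = refl

module Antichains {n : ℕ} (P : NLPoset n) (j : ℕ) where
  open NLPoset P
  open PPartitions P
  open MarkedMaps P j

  private
    maps : List Map
    maps = allMaps n (suc (suc j))

  -- The binomial transform of the antichain numbers counts the marked pairs:
  -- an antichain of size m contains m C j subsets of size j.
  count-markedPairs : count MarkedPair? (allPairs n) ≡ sumTo n (λ m → (m C j) * numAntichains P m)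
  count-markedPairs = begin
    count MarkedPair? (allPairs n)
      ≡⟨ count-cartesianProduct MarkedPair? (allSubsets n) (allSubsets n) ⟩
    sum (map (λ A → count (λ B → MarkedPair? (A , B)) (allSubsets n)) (allSubsets n))
      ≡⟨ cong sum (List.map-cong per-antichain (allSubsets n)) ⟩
    sum (map (λ A → bit (does (isAntichain? P A)) * (∣ A ∣ C j)) (allSubsets n))
      ≡⟨ sum-by-value (isAntichain? P) ∣_∣ (_C j) n (allSubsets n) ∣p∣≤n ⟩
    sumTo n (λ m → (m C j) * numAntichains P m) ∎
    where
    open ≡-Reasoning
    per-antichain : ∀ A → count (λ B → MarkedPair? (A , B)) (allSubsets n) ≡ bit (does (isAntichain? P A)) * (∣ A ∣ C j)
    per-antichain A = by-decision (isAntichain? P A)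
      where
      by-decision : (d : Dec (IsAntichain P A)) → count (λ B → d ×-dec Sub? A j B) (allSubsets n) ≡ bit (does d) * (∣ A ∣ C j)
      by-decision (yes anti) = trans (count-ext (λ B → yes anti ×-dec Sub? A j B) (Sub? A j) (λ B (_ , B⊆ , e) → B⊆ , e)
                                                (λ B (B⊆ , e) → anti , B⊆ , e) (allSubsets n))
                                     (trans (count-subsets n A j) (sym (+-identityʳ _)))
      by-decision (no ¬anti) = count-zero (λ B → no ¬anti ×-dec Sub? A j B) (λ B (anti , _) → ¬anti anti) (allSubsets n)

  count-marked≡pairs : count Marked? maps ≡ count MarkedPair? (allPairs n)
  count-marked≡pairs = count-bijection Marked? MarkedPair? maps (allPairs n) (allMaps-unique n _) (allPairs-unique n)
    (λ σ _ → allMaps-complete n _ σ) (λ p _ → allPairs-complete n p) toPair fromPair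
    (λ σ marked → ToPair.markedPair σ marked) (λ { (A , B) pair → FromPair.marked A B pair })
    (λ σ marked → ToPair.fromPair∘toPair σ marked) (λ { (A , B) pair → FromPair.toPair∘fromPair A B pair })

  count-marked≡admissible : count Marked? maps ≡ sumTo n (λ a → sumTo n (λ b → admissible (suc j) (markedContent j a b) middleFlags))
  count-marked≡admissible =
    trans (count-by-value Marked? (λ σ → fiber σ 0) n maps (fiber≤n 0))
      (sumTo-ext n _ _ λ a _ → trans (count-by-value (λ σ → Marked? σ ×-dec (fiber σ 0 ≟ a)) (λ σ → fiber σ (suc j)) n maps
                                                     (fiber≤n (suc j)))
        (sumTo-ext n _ _ λ b _ → count-ext _ _ (to a b) (from a b) maps))
    where
    fiber≤n : ∀ v (σ : Map) → fiber σ v ≤ n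
    fiber≤n v σ = ≤-trans (List.length-filter (λ x → level σ x ≟ v) (allFin n)) (≤-reflexive (List.length-tabulate (λ x → x)))
    to : ∀ a b σ → (Marked σ × fiber σ 0 ≡ a) × fiber σ (suc j) ≡ b → Admissible (suc j) (markedContent j a b) middleFlags σ
    to a b σ (((pp , singles , noAsc) , bottom) , top) = pp , ⇒content {σ = σ} {α = markedContent j a b} fibers , noAsc
      where
      fibers : ∀ v → v < suc (suc j) → fiber σ v ≡ markedContent j a b v
      fibers zero _ = bottom
      fibers (suc u) u<j+1 with u <? j
      ... | yes u<j = trans (singletonMiddle⇒ σ singles (suc u) (s≤s z≤n) u<j) (sym (markedContent-middle j a b u u<j))
      ... | no  u≮j with ≤-antisym (≤-pred (≤-pred u<j+1)) (≮⇒≥ u≮j)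
      ... | refl = trans top (sym (markedContent-top j a b))
    from : ∀ a b σ → Admissible (suc j) (markedContent j a b) middleFlags σ → (Marked σ × fiber σ 0 ≡ a) × fiber σ (suc j) ≡ b
    from a b σ (pp , cn , noAsc) = ((pp , singles , noAsc) , fibers 0 (s≤s z≤n)) , trans (fibers (suc j) ≤-refl) (markedContent-top j a b)
      where
      fibers = content⇒ {σ = σ} {α = markedContent j a b} cn
      singles : SingletonMiddle σ
      singles w = trans (fibers (suc (toℕ w)) (s≤s (m≤n⇒m≤1+n (toℕ<n w)))) (markedContent-middle j a b (toℕ w) (toℕ<n w))

  binomialTransform≡admissible :
    sumTo n (λ m → (m C j) * numAntichains P m) ≡ sumTo n (λ a → sumTo n (λ b → admissible (suc j) (markedContent j a b) middleFlags))
  binomialTransform≡admissible = trans (sym count-markedPairs) (trans (sym count-marked≡pairs) count-marked≡admissible)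

-- The marked contents are good for the middle flags: the levels around a flag
-- 0 < w < j are singletons.
markedContent-good : ∀ {n} (P : NLPoset n) j a b → Good (suc j) (markedContent j a b) (MarkedMaps.middleFlags P j)
markedContent-good P j a b zero _ ()
markedContent-good P j a b (suc u) _ flag =
  subst (0 <_) (sym (markedContent-middle j a b u (<-trans (n<1+n u) su<j))) (s≤s z≤n) ,
  subst (0 <_) (sym (markedContent-middle j a b (suc u) su<j)) (s≤s z≤n)
  where
  su<j : suc u < j
  su<j = does-true⇒ (suc u <? j) flag

-- The coefficient of x₁^c in K_P is 1 if c is the size m of P and 0 otherwise:
-- the only map into a single level is the constant one.
coeffK-one-level : ∀ {m} (R : NLPoset m) c → coeffK R 1 (λ _ → c) ≡ bit (does (c ≟ m))
coeffK-one-level {m} R c = begin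
  coeffK R 1 (λ _ → c)                            ≡⟨ cong (count decide) (only-constant m) ⟩
  count decide (constant ∷ [])                    ≡⟨ trans (count-∷ decide constant []) (+-identityʳ _) ⟩
  bit (does (decide constant))
    ≡⟨ same-decision (decide constant) (c ≟ m) (λ (_ , sizes) → trans (sym (sizes fzero)) fiber-m)
                     (λ c≡m → constant-isPPartition , λ { fzero → trans fiber-m (sym c≡m) }) ⟩
  bit (does (c ≟ m))                              ∎
  where
  open ≡-Reasoning
  constant : Vec (Fin 1) m
  constant = replicate m fzero
  decide : (σ : Vec (Fin 1) m) → Dec (IsPPartition R σ × HasContent R σ (λ _ → c))
  decide σ = isPPartition? R σ ×-dec hasContent? R σ (λ _ → c)
  only-constant : ∀ m → allMaps m 1 ≡ replicate m fzero ∷ []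
  only-constant zero = refl
  only-constant (suc m) rewrite only-constant m = refl
  fiber-m : fiberSize R constant fzero ≡ m
  fiber-m = trans (count-all (λ x → lookup constant x Fin.≟ fzero) (λ x → lookup-replicate x fzero) (allFin m))
                  (List.length-tabulate (λ x → x))
  constant-isPPartition : IsPPartition R constant
  constant-isPPartition x y _ = subst₂ (λ a b → toℕ a ≤ toℕ b) (sym (lookup-replicate x fzero)) (sym (lookup-replicate y fzero)) z≤n
  same-decision : ∀ {X Y : Set} (x? : Dec X) (y? : Dec Y) → (X → Y) → (Y → X) → bit (does x?) ≡ bit (does y?)
  same-decision (yes x) y? f g = sym (bit-yes y? (f x))
  same-decision (no ¬x) y? f g = sym (bit-no y? (λ y → ¬x (g y)))

size-determined : ∀ {n n'} (P : NLPoset n) (Q : NLPoset n') → SameK P Q → n ≡ n'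
size-determined {n} {n'} P Q sameK with n ≟ n'
... | yes n≡n' = n≡n'
... | no  n≢n' = ⊥-elim (1≢0 (begin
  1                      ≡⟨ sym (bit-yes (n ≟ n) refl) ⟩
  bit (does (n ≟ n))     ≡⟨ sym (coeffK-one-level P n) ⟩
  coeffK P 1 (λ _ → n)   ≡⟨ sameK 1 (λ _ → n) ⟩
  coeffK Q 1 (λ _ → n)   ≡⟨ coeffK-one-level Q n ⟩
  bit (does (n ≟ n'))    ≡⟨ bit-no (n ≟ n') n≢n' ⟩
  0                      ∎))
  where
  open ≡-Reasoning
  1≢0 : 1 ≢ 0
  1≢0 ()

corollary3p5 : ∀ {n n' : ℕ} (P : NLPoset n) (Q : NLPoset n') →
    SameK P Q → ∀ (m : ℕ) → numAntichains P m ≡ numAntichains Q m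
corollary3p5 {n} P Q sameK with size-determined P Q sameK
... | refl = binomial-inversion n (numAntichains P) (numAntichains Q) (no-large P) (no-large Q) same-transforms
  where
  no-large : ∀ {n} (R : NLPoset n) m → n < m → numAntichains R m ≡ 0
  no-large {n} R m n<m =
    count-zero _ (λ S (_ , size≡m) → <-irrefl refl (<-≤-trans n<m (subst (_≤ n) size≡m (∣p∣≤n S)))) (allSubsets n)
  same-transforms : ∀ j → sumTo n (λ m → (m C j) * numAntichains P m) ≡ sumTo n (λ m → (m C j) * numAntichains Q m)
  same-transforms j = trans (Antichains.binomialTransform≡admissible P j)
    (trans (sumTo-ext n _ _ λ a _ → sumTo-ext n _ _ λ b _ →
              admissible-determined P Q sameK (suc j) (markedContent j a b) (MarkedMaps.middleFlags P j) (markedContent-good P j a b))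
           (sym (Antichains.binomialTransform≡admissible Q j)))
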